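{- Let $\alpha=(\alpha_1,\ldots,\alpha_n)$ and $\beta=(\beta_1,\ldots,\beta_m)$ be compositions of $N$ and $d$ a nonnegative integer. The map $\theta:\mathfrak{S}_d(\alpha,\beta)\to\mathfrak{T}_d(\alpha,\beta)$ defined below is well defined (its image lies in $\mathfrak{T}_d(\alpha,\beta)$) and is a bijection.
   Context: $\mathfrak{S}_d(\alpha,\beta)$ is the set of pairs $(P,Q)$ of semistandard Young tableaux (SSYTs) of a common shape $\lambda=(\lambda_1,\lambda_2,\ldots)$ contained in the rectangle $(d^m)$ ($m$ rows of length $d$), with $P$ of type $\alpha$ (entry $i$ occurs $\alpha_i$ times) and $Q$ of type $\beta$. $\mathfrak{T}_d(\alpha,\beta)$ is the set of SSYTs of shape $(d^m)$ and type $(\alpha_1,\ldots,\alpha_n,d-\beta_m,d-\beta_{m-1},\ldots,d-\beta_1)$ (entries $1,\ldots,n+m$). For $(P,Q)\in\mathfrak{S}_d(\alpha,\beta)$ with $Q=(Q_{ij})$, set $\lambda_i(k)=\#\{j\mid Q_{ij}\le k\}$ for $i\ge1$, $0\le k\le m$ (zero when row $i$ is empty), and $\lambda_0(k)=d$. Define $T=\theta(P,Q)=(T_{ij})$ of shape $(d^m)$ by: $T_{ij}=P_{ij}$ if $1\le i\le \ell(\lambda)$ and $1\le j\le\lambda_i$; and for $1\le k\le m$, $T_{ij}=n+k$ if $k\le i\le m$ and $\lambda_{i-k+1}(m-k+1)<j\le\lambda_{i-k}(m-k)$. -}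

module Defs where

open import Data.Nat using (ℕ; zero; suc; _+_; _∸_; _≤_; _<_; _≤ᵇ_; _≡ᵇ_)
open import Data.Bool using (Bool; true; false)
open import Data.Fin using (Fin; toℕ)
open import Data.List as List using (List; []; _∷_; length; filter; replicate; applyUpTo; concat; _++_)
open import Data.Nat.ListAction using (sum)
open import Data.List.Relation.Unary.Linked using (Linked)
open import Data.Vec as Vec using (Vec; lookup; tabulate; toList; reverse)
open import Data.Vec.Relation.Unary.All using (All)
open import Data.Product using (_×_)
open import Relation.Binary.PropositionalEquality using (_≡_)
open import Relation.Nullary.Decidable using (T?)

-- A tableau whose shape is contained in the rectangle (d^m) is represented by its
-- m rows (Vec of length m), each row a list of entries read left to right
-- (empty rows allowed).
Tableau : ℕ → Set
Tableau m = Vec (List ℕ) m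

-- entry at position j (0-based) of a list, default 0 outside
at : List ℕ → ℕ → ℕ
at []       _       = 0
at (x ∷ xs) zero    = x
at (x ∷ xs) (suc j) = at xs j

rowAt : List (List ℕ) → ℕ → List ℕ
rowAt []         _       = []
rowAt (r ∷ rs)   zero    = r
rowAt (r ∷ rs)   (suc i) = rowAt rs i

IsComposition : ∀ {n} → ℕ → Vec ℕ n → Set
IsComposition N α = All (λ a → 0 < a) α × Vec.sum α ≡ N

record IsSSYT {m : ℕ} (T : Tableau m) : Set where
  field
    shapeDecr : ∀ (r₁ r₂ : Fin m) → toℕ r₁ ≤ toℕ r₂ →
                length (lookup T r₂) ≤ length (lookup T r₁)
    rowsWeak  : ∀ (r : Fin m) → Linked _≤_ (lookup T r)
    colsStrict : ∀ (r₁ r₂ : Fin m) (j : ℕ) → toℕ r₁ < toℕ r₂ →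
                 j < length (lookup T r₂) →
                 at (lookup T r₁) j < at (lookup T r₂) j

count : ∀ {m} → ℕ → Tableau m → ℕ
count k T = sum (List.map (λ row → length (filter (λ x → T? (k ≡ᵇ x)) row)) (toList T))

-- the k-th part (1-based) of a sequence γ = (γ₁,…,γₗ); 0 outside 1..l
part : ∀ {l} → Vec ℕ l → ℕ → ℕ
part γ zero    = 0
part γ (suc k) = at (toList γ) k

-- T has type γ: entry k occurs γ_k times (and no other entries occur)
HasType : ∀ {m l} → Tableau m → Vec ℕ l → Set
HasType T γ = ∀ k → count k T ≡ part γ k

InS : ∀ {n m} (d : ℕ) (α : Vec ℕ n) (β : Vec ℕ m) → Tableau m → Tableau m → Set
InS {n} {m} d α β P Q =
  IsSSYT P × IsSSYT Q ×
  Vec.map length P ≡ Vec.map length Q ×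
  (∀ (r : Fin m) → length (lookup P r) ≤ d) ×
  HasType P α × HasType Q β

TType : ∀ {n m} (d : ℕ) (α : Vec ℕ n) (β : Vec ℕ m) → Vec ℕ (n + m)
TType d α β = α Vec.++ reverse (Vec.map (d ∸_) β)

InT : ∀ {n m} (d : ℕ) (α : Vec ℕ n) (β : Vec ℕ m) → Tableau m → Set
InT {n} {m} d α β T =
  IsSSYT T × (∀ (r : Fin m) → length (lookup T r) ≡ d) × HasType T (TType d α β)

-- λ_i(k) = #{ j | Q_ij ≤ k } for i ≥ 1 (0 if row i is empty/absent), λ_0(k) = d
lam : ∀ {m} (d : ℕ) (Q : Tableau m) → ℕ → ℕ → ℕ
lam d Q zero    k = d
lam d Q (suc i) k = length (filter (λ x → T? (x ≤ᵇ k)) (rowAt (toList Q) i))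

-- θ(P,Q): row i (1-based) is P_i followed, for k = 1,…,i, by the entries n+k in
-- the columns j with λ_{i-k+1}(m-k+1) < j ≤ λ_{i-k}(m-k).
theta : ∀ {m} (d n : ℕ) → Tableau m → Tableau m → Tableau m
theta {m} d n P Q = tabulate λ r →
  let i = suc (toℕ r) in
  lookup P r ++
  concat (applyUpTo (λ k' → let k = suc k' in
            replicate (lam d Q (i ∸ k) (m ∸ k) ∸ lam d Q (i ∸ k + 1) (m ∸ k + 1)) (n + k))
          i)

module Submission where

-- A weakly increasing row is determined by its counting function v ↦ #{entries ≤ v}, and a
-- tableau with positive entries is semistandard exactly when its rows are sorted, its shape
-- is a partition and row i + 1 has at most as many entries ≤ v + 1 as row i has entries ≤ v.
-- In these terms θ is transparent: below n, row I of θ(P, Q) has the counting function of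
-- row I of P, while its number of entries ≤ n + K is λ_{I-K}(m-K).  The column conditions of
-- P and Q therefore turn into those of θ(P, Q), its type follows by telescoping these counts
-- over the rows, and Q is recovered from θ(P, Q) via
-- λ_i(t) = #{entries ≤ n + m - t in row i + m - t} for i < t.  Conversely, for T in
-- 𝔗_d(α,β) let P consist of the entries ≤ n of T and let Q have the row counting functions
-- read off T in the same way; Q then has type β because its parts are bounded by those of β
-- and both add up to N.

open import Defs
open import Data.Nat using (ℕ)
open import Data.Vec using (Vec)
open import Data.Product using (_×_; Σ; _,_)
open import Relation.Binary.PropositionalEquality using (_≡_)

open import Data.Empty using (⊥-elim)
open import Data.Fin as Fin using (Fin; toℕ; fromℕ<)
open import Data.Fin.Properties using (toℕ-fromℕ<; toℕ<n)
open import Data.List as List using (List; []; _∷_; length; filter; replicate; applyUpTo; concat; _++_; [_])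
open import Data.List.Properties
  using ( filter-accept; filter-reject; filter-++; length-++; length-map; length-replicate; length-reverse
        ; unfold-reverse; applyUpTo-∷ʳ; concat-++; ++-identityʳ)
open import Data.List.Relation.Unary.All as All using (All; []; _∷_)
import Data.List.Relation.Unary.All.Properties as All
open import Data.List.Relation.Unary.AllPairs using (AllPairs; []; _∷_)
import Data.List.Relation.Unary.AllPairs.Properties as AllPairs
open import Data.List.Relation.Unary.Linked using (Linked)
open import Data.List.Relation.Unary.Linked.Properties using (AllPairs⇒Linked; Linked⇒AllPairs)
open import Data.Nat
  using (zero; suc; _+_; _*_; _∸_; _⊓_; _≤_; _<_; _≰_; _≤ᵇ_; _≡ᵇ_; z≤n; s≤s; _≤?_; _<?_)
open import Data.Nat.Properties
open import Algebra.Properties.CommutativeSemigroup +-commutativeSemigroup using (interchange)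
open import Data.Nat.Solver using (module +-*-Solver)
open import Data.Product using (proj₁; proj₂)
open import Data.Sum using (inj₁; inj₂)
import Data.Vec as Vec
open import Data.Vec.Properties using (lookup∘tabulate; length-toList; toList-++; toList-map; toList-reverse)
open import Function using (_∘′_)
open import Relation.Nullary using (Dec; yes; no)
open import Relation.Nullary.Decidable using (T?)
open import Relation.Binary.PropositionalEquality
  using (_≢_; refl; sym; trans; cong; cong₂; subst; subst₂; module ≡-Reasoning)

open +-*-Solver using (solve; _:+_; _:=_)

∸-suc : ∀ {k I} → k < I → I ∸ k ≡ suc (I ∸ suc k)
∸-suc = +-∸-assoc 1

1+[m+n]∸m≡1+n : ∀ m n → suc (m + n) ∸ m ≡ suc n
1+[m+n]∸m≡1+n m n = trans (+-∸-assoc 1 (m≤m+n m n)) (cong suc (m+n∸m≡n m n))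

m∸[m∸n]≤n : ∀ m n → m ∸ (m ∸ n) ≤ n
m∸[m∸n]≤n m n with n ≤? m
... | yes n≤m = ≤-reflexive (m∸[m∸n]≡n n≤m)
... | no n≰m  = subst (_≤ n) (sym (cong (m ∸_) (m≤n⇒m∸n≡0 m≤n))) m≤n
  where m≤n = <⇒≤ (≰⇒> n≰m)

-- Counting functions of lists

filter≤ : ℕ → List ℕ → List ℕ
filter≤ v = filter (λ x → T? (x ≤ᵇ v))

#≤ : ℕ → List ℕ → ℕ
#≤ v xs = length (filter≤ v xs)

#≡ : ℕ → List ℕ → ℕ
#≡ k xs = length (filter (λ x → T? (k ≡ᵇ x)) xs)

Sorted : List ℕ → Set
Sorted = AllPairs _≤_

filter≤-∷-≤ : ∀ {x v} xs → x ≤ v → filter≤ v (x ∷ xs) ≡ x ∷ filter≤ v xs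
filter≤-∷-≤ {x} {v} xs x≤v = filter-accept (λ y → T? (y ≤ᵇ v)) {x} {xs} (≤⇒≤ᵇ x≤v)

filter≤-∷-≰ : ∀ {x v} xs → x ≰ v → filter≤ v (x ∷ xs) ≡ filter≤ v xs
filter≤-∷-≰ {x} {v} xs x≰v = filter-reject (λ y → T? (y ≤ᵇ v)) {x} {xs} (x≰v ∘′ ≤ᵇ⇒≤ x v)

#≤-∷-≤ : ∀ {x v} xs → x ≤ v → #≤ v (x ∷ xs) ≡ suc (#≤ v xs)
#≤-∷-≤ xs x≤v = cong length (filter≤-∷-≤ xs x≤v)

#≤-∷-≰ : ∀ {x v} xs → x ≰ v → #≤ v (x ∷ xs) ≡ #≤ v xs
#≤-∷-≰ xs x≰v = cong length (filter≤-∷-≰ xs x≰v)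

#≡-∷-≡ : ∀ {x k} xs → k ≡ x → #≡ k (x ∷ xs) ≡ suc (#≡ k xs)
#≡-∷-≡ {x} {k} xs k≡x = cong length (filter-accept (λ y → T? (k ≡ᵇ y)) {x} {xs} (≡⇒≡ᵇ k x k≡x))

#≡-∷-≢ : ∀ {x k} xs → k ≢ x → #≡ k (x ∷ xs) ≡ #≡ k xs
#≡-∷-≢ {x} {k} xs k≢x = cong length (filter-reject (λ y → T? (k ≡ᵇ y)) {x} {xs} (k≢x ∘′ ≡ᵇ⇒≡ k x))

#≤-++ : ∀ v xs ys → #≤ v (xs ++ ys) ≡ #≤ v xs + #≤ v ys
#≤-++ v xs ys = trans (cong length (filter-++ (λ y → T? (y ≤ᵇ v)) xs ys)) (length-++ (filter≤ v xs))

#≤≤length : ∀ v xs → #≤ v xs ≤ length xs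
#≤≤length v [] = z≤n
#≤≤length v (x ∷ xs) with x ≤? v
... | yes x≤v = ≤-trans (≤-reflexive (#≤-∷-≤ xs x≤v)) (s≤s (#≤≤length v xs))
... | no x≰v  = ≤-trans (≤-reflexive (#≤-∷-≰ xs x≰v)) (m≤n⇒m≤1+n (#≤≤length v xs))

#≤-mono : ∀ {v w} xs → v ≤ w → #≤ v xs ≤ #≤ w xs
#≤-mono [] v≤w = z≤n
#≤-mono {v} {w} (x ∷ xs) v≤w with x ≤? v | x ≤? w
... | yes x≤v | yes x≤w = subst₂ _≤_ (sym (#≤-∷-≤ xs x≤v)) (sym (#≤-∷-≤ xs x≤w)) (s≤s (#≤-mono xs v≤w))
... | yes x≤v | no x≰w  = ⊥-elim (x≰w (≤-trans x≤v v≤w))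
... | no x≰v  | yes x≤w =
  subst₂ _≤_ (sym (#≤-∷-≰ xs x≰v)) (sym (#≤-∷-≤ xs x≤w)) (m≤n⇒m≤1+n (#≤-mono xs v≤w))
... | no x≰v  | no x≰w  = subst₂ _≤_ (sym (#≤-∷-≰ xs x≰v)) (sym (#≤-∷-≰ xs x≰w)) (#≤-mono xs v≤w)

#≤-all : ∀ {v} xs → All (_≤ v) xs → #≤ v xs ≡ length xs
#≤-all [] [] = refl
#≤-all (x ∷ xs) (x≤v ∷ xs≤v) = trans (#≤-∷-≤ xs x≤v) (cong suc (#≤-all xs xs≤v))

#≤-none : ∀ {v} xs → All (v <_) xs → #≤ v xs ≡ 0
#≤-none [] [] = refl
#≤-none (x ∷ xs) (v<x ∷ v<xs) = trans (#≤-∷-≰ xs (<⇒≱ v<x)) (#≤-none xs v<xs)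

#≤-replicate-≤ : ∀ {v x} c → x ≤ v → #≤ v (replicate c x) ≡ c
#≤-replicate-≤ c x≤v = trans (#≤-all (replicate c _) (All.replicate⁺ c x≤v)) (length-replicate c)

#≤-replicate-≰ : ∀ {v x} c → x ≰ v → #≤ v (replicate c x) ≡ 0
#≤-replicate-≰ c x≰v = #≤-none (replicate c _) (All.replicate⁺ c (≰⇒> x≰v))

#≤-sorted-∷-≰ : ∀ {x v} xs → Sorted (x ∷ xs) → x ≰ v → #≤ v (x ∷ xs) ≡ 0
#≤-sorted-∷-≰ xs (x≤xs ∷ _) x≰v =
  trans (#≤-∷-≰ xs x≰v) (#≤-none xs (All.map (<-≤-trans (≰⇒> x≰v)) x≤xs))

All⇒at : ∀ {P : ℕ → Set} {xs} j → All P xs → j < length xs → P (at xs j)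
All⇒at zero    (px ∷ _)  _         = px
All⇒at (suc j) (_ ∷ pxs) (s≤s j<l) = All⇒at j pxs j<l

at≤⇒<#≤ : ∀ {v} xs j → Sorted xs → j < length xs → at xs j ≤ v → j < #≤ v xs
at≤⇒<#≤ (x ∷ xs) zero    _          _         x≤v = ≤-trans (s≤s z≤n) (≤-reflexive (sym (#≤-∷-≤ xs x≤v)))
at≤⇒<#≤ {v} (x ∷ xs) (suc j) (x≤xs ∷ s) (s≤s j<l) at≤v with x ≤? v
... | yes x≤v = subst (suc j <_) (sym (#≤-∷-≤ xs x≤v)) (s≤s (at≤⇒<#≤ xs j s j<l at≤v))
... | no x≰v  = ⊥-elim (x≰v (≤-trans (All⇒at j x≤xs j<l) at≤v))

<#≤⇒at≤ : ∀ {v} xs j → Sorted xs → j < #≤ v xs → at xs j ≤ v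
<#≤⇒at≤ {v} (x ∷ xs) j s j<# with x ≤? v
<#≤⇒at≤ {v} (x ∷ xs) zero    s          j<# | yes x≤v = x≤v
<#≤⇒at≤ {v} (x ∷ xs) (suc j) (_ ∷ s)    j<# | yes x≤v =
  <#≤⇒at≤ xs j s (≤-pred (subst (suc j <_) (#≤-∷-≤ xs x≤v) j<#))
... | no x≰v = ⊥-elim (n≮0 (≤-trans j<# (≤-reflexive (#≤-sorted-∷-≰ xs s x≰v))))

#≤-⊓ : ∀ {n} xs → All (_≤ n) xs → ∀ v → #≤ v xs ≡ #≤ (v ⊓ n) xs
#≤-⊓ {n} xs xs≤n v with v ≤? n
... | yes v≤n = cong (λ w → #≤ w xs) (sym (m≤n⇒m⊓n≡m v≤n))
... | no v≰n  = trans (#≤-all xs (All.map (λ x≤n → ≤-trans x≤n n≤v) xs≤n))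
                      (trans (sym (#≤-all xs xs≤n)) (cong (λ w → #≤ w xs) (sym (m≥n⇒m⊓n≡n n≤v))))
  where n≤v = <⇒≤ (≰⇒> v≰n)

#≤-filter≤ : ∀ n v xs → #≤ v (filter≤ n xs) ≡ #≤ (v ⊓ n) xs
#≤-filter≤ n v [] = refl
#≤-filter≤ n v (x ∷ xs) with x ≤? n | x ≤? v
... | yes x≤n | yes x≤v = trans (cong (#≤ v) (filter≤-∷-≤ xs x≤n))
  (trans (#≤-∷-≤ _ x≤v) (trans (cong suc (#≤-filter≤ n v xs)) (sym (#≤-∷-≤ xs (⊓-glb x≤v x≤n)))))
... | yes x≤n | no x≰v  = trans (cong (#≤ v) (filter≤-∷-≤ xs x≤n))
  (trans (#≤-∷-≰ _ x≰v) (trans (#≤-filter≤ n v xs)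
    (sym (#≤-∷-≰ xs (λ x≤v⊓n → x≰v (≤-trans x≤v⊓n (m⊓n≤m v n)))))))
... | no x≰n  | _       = trans (cong (#≤ v) (filter≤-∷-≰ xs x≰n))
  (trans (#≤-filter≤ n v xs) (sym (#≤-∷-≰ xs (λ x≤v⊓n → x≰n (≤-trans x≤v⊓n (m⊓n≤n v n))))))

-- The counting form of "ys may stand directly below xs in a semistandard tableau".
Shifted : List ℕ → List ℕ → Set
Shifted xs ys = ∀ v → #≤ (suc v) ys ≤ #≤ v xs

ColumnStrict : List ℕ → List ℕ → Set
ColumnStrict xs ys = ∀ j → j < length ys → at xs j < at ys j

shifted⇒columnStrict : ∀ xs ys → Sorted xs → Sorted ys →
  Shifted xs ys → #≤ 0 ys ≡ 0 → ColumnStrict xs ys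
shifted⇒columnStrict xs ys sx sy sh no-zero j j<l with at ys j in eq
... | zero  = ⊥-elim (n≮0 (subst (j <_) no-zero (at≤⇒<#≤ ys j sy j<l (≤-reflexive eq))))
... | suc w = s≤s (<#≤⇒at≤ xs j sx (<-≤-trans (at≤⇒<#≤ ys j sy j<l (≤-reflexive eq)) (sh w)))

columnStrict⇒shifted : ∀ xs ys → Sorted xs → Sorted ys → length ys ≤ length xs →
  ColumnStrict xs ys → Shifted xs ys
columnStrict⇒shifted xs ys sx sy ys≤xs cs v with #≤ (suc v) ys in eq
... | zero  = z≤n
... | suc c = at≤⇒<#≤ xs c sx (<-≤-trans c<l ys≤xs)
                (≤-pred (<-≤-trans (cs c c<l) (<#≤⇒at≤ ys c sy (≤-reflexive (sym eq)))))
  where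
  c<l : c < length ys
  c<l = <-≤-trans (≤-reflexive (sym eq)) (#≤≤length (suc v) ys)

#≤-injective : ∀ xs ys → Sorted xs → Sorted ys → (∀ v → #≤ v xs ≡ #≤ v ys) → xs ≡ ys
#≤-injective [] [] _ _ _ = refl
#≤-injective [] (y ∷ ys) _ _ eq = ⊥-elim (1+n≢0 (trans (sym (#≤-∷-≤ {y} ys ≤-refl)) (sym (eq y))))
#≤-injective (x ∷ xs) [] _ _ eq = ⊥-elim (1+n≢0 (trans (sym (#≤-∷-≤ {x} xs ≤-refl)) (eq x)))
#≤-injective (x ∷ xs) (y ∷ ys) sx@(_ ∷ sxs) sy@(_ ∷ sys) eq =
  cong₂ _∷_ x≡y (#≤-injective xs ys sxs sys tails)
  where
  head≤ : ∀ {a b as bs} → Sorted (b ∷ bs) → (∀ v → #≤ v (a ∷ as) ≡ #≤ v (b ∷ bs)) → b ≤ a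
  head≤ {a} {b} {as} {bs} sb eq′ with b ≤? a
  ... | yes b≤a = b≤a
  ... | no b≰a  = ⊥-elim (1+n≢0 (trans (sym (#≤-∷-≤ {a} as ≤-refl)) (trans (eq′ a) (#≤-sorted-∷-≰ bs sb b≰a))))
  x≡y : x ≡ y
  x≡y = ≤-antisym (head≤ sx (λ v → sym (eq v))) (head≤ sy eq)
  tails : ∀ v → #≤ v xs ≡ #≤ v ys
  tails v with x ≤? v
  ... | yes x≤v = suc-injective (trans (sym (#≤-∷-≤ xs x≤v)) (trans (eq v) (#≤-∷-≤ ys (subst (_≤ v) x≡y x≤v))))
  ... | no x≰v  = trans (sym (#≤-∷-≰ xs x≰v)) (trans (eq v) (#≤-∷-≰ ys (x≰v ∘′ subst (_≤ v) (sym x≡y))))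

#≤0≡#≡0 : ∀ xs → #≤ 0 xs ≡ #≡ 0 xs
#≤0≡#≡0 [] = refl
#≤0≡#≡0 (zero ∷ xs)  = trans (#≤-∷-≤ xs z≤n) (trans (cong suc (#≤0≡#≡0 xs)) (sym (#≡-∷-≡ {0} {0} xs refl)))
#≤0≡#≡0 (suc x ∷ xs) =
  trans (#≤-∷-≰ {suc x} {0} xs λ ()) (trans (#≤0≡#≡0 xs) (sym (#≡-∷-≢ {suc x} {0} xs λ ())))

#≤-suc : ∀ k xs → #≤ (suc k) xs ≡ #≤ k xs + #≡ (suc k) xs
#≤-suc k [] = refl
#≤-suc k (x ∷ xs) with x ≤? k | x ≤? suc k
... | yes x≤k | _ = trans (#≤-∷-≤ xs (m≤n⇒m≤1+n x≤k)) (trans (cong suc (#≤-suc k xs))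
      (cong₂ _+_ (sym (#≤-∷-≤ xs x≤k)) (sym (#≡-∷-≢ xs (λ k+1≡x → 1+n≰n (subst (_≤ k) (sym k+1≡x) x≤k))))))
... | no x≰k | yes x≤k+1 = trans (#≤-∷-≤ xs x≤k+1) (trans (cong suc (#≤-suc k xs)) (trans (sym (+-suc _ _))
      (cong₂ _+_ (sym (#≤-∷-≰ xs x≰k)) (sym (#≡-∷-≡ xs (≤-antisym (≰⇒> x≰k) x≤k+1))))))
... | no x≰k | no x≰k+1 = trans (#≤-∷-≰ xs x≰k+1) (trans (#≤-suc k xs)
      (cong₂ _+_ (sym (#≤-∷-≰ xs x≰k)) (sym (#≡-∷-≢ xs (x≰k+1 ∘′ ≤-reflexive ∘′ sym)))))

All-from-#≡ : ∀ {P : ℕ → Set} xs → (∀ k → 0 < #≡ k xs → P k) → All P xs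
All-from-#≡ [] _ = []
All-from-#≡ (x ∷ xs) h = h x x-occurs ∷ All-from-#≡ xs (λ k k-occurs → h k (<-≤-trans k-occurs (#≡-∷-≥ k)))
  where
  x-occurs : 0 < #≡ x (x ∷ xs)
  x-occurs = ≤-trans (s≤s z≤n) (≤-reflexive (sym (#≡-∷-≡ {x} {x} xs refl)))
  #≡-∷-≥ : ∀ k → #≡ k xs ≤ #≡ k (x ∷ xs)
  #≡-∷-≥ k with k ≟ x
  ... | yes k≡x = subst (#≡ k xs ≤_) (sym (#≡-∷-≡ xs k≡x)) (n≤1+n _)
  ... | no k≢x  = ≤-reflexive (sym (#≡-∷-≢ xs k≢x))

-- Lists with a prescribed counting function

-- Shifted by o, its counting function is v ↦ g (v ⊓ t) ∸ g 0; the tails of the rows of θ and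
-- the rows of the preimage under θ are of this form.
staircase : (ℕ → ℕ) → ℕ → ℕ → List ℕ
staircase g o zero    = []
staircase g o (suc t) = staircase g o t ++ replicate (g (suc t) ∸ g t) (o + suc t)

Sorted-replicate : ∀ c x → Sorted (replicate c x)
Sorted-replicate zero    x = []
Sorted-replicate (suc c) x = All.replicate⁺ c ≤-refl ∷ Sorted-replicate c x

staircase-bounded : ∀ g o t → All (λ x → o < x × x ≤ o + t) (staircase g o t)
staircase-bounded g o zero = []
staircase-bounded g o (suc t) = All.++⁺
  (All.map (λ (o<x , x≤o+t) → o<x , ≤-trans x≤o+t (+-monoʳ-≤ o (n≤1+n t))) (staircase-bounded g o t))
  (All.replicate⁺ _ (m<m+n o (s≤s z≤n) , ≤-refl))

staircase-sorted : ∀ g o t → Sorted (staircase g o t)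
staircase-sorted g o zero = []
staircase-sorted g o (suc t) = AllPairs.++⁺ (staircase-sorted g o t) (Sorted-replicate _ _)
  (All.map (λ (_ , x≤o+t) → All.replicate⁺ _ (≤-trans x≤o+t (+-monoʳ-≤ o (n≤1+n t)))) (staircase-bounded g o t))

#≤-staircase-low : ∀ g o t {v} → v ≤ o → #≤ v (staircase g o t) ≡ 0
#≤-staircase-low g o t v≤o = #≤-none (staircase g o t) (All.map (λ (o<x , _) → ≤-<-trans v≤o o<x) (staircase-bounded g o t))

#≤-staircase : ∀ g o t → (∀ s → s < t → g s ≤ g (suc s)) →
  ∀ v → g 0 + #≤ (o + v) (staircase g o t) ≡ g (v ⊓ t)
#≤-staircase g o zero    mono v = trans (+-identityʳ (g 0)) (cong g (sym (⊓-zeroʳ v)))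
#≤-staircase g o (suc t) mono v = begin
  g 0 + #≤ (o + v) (staircase g o t ++ step)        ≡⟨ cong (g 0 +_) (#≤-++ (o + v) (staircase g o t) step) ⟩
  g 0 + (#≤ (o + v) (staircase g o t) + #≤ (o + v) step) ≡⟨ sym (+-assoc (g 0) _ _) ⟩
  g 0 + #≤ (o + v) (staircase g o t) + #≤ (o + v) step   ≡⟨ cong (_+ #≤ (o + v) step) (#≤-staircase g o t mono′ v) ⟩
  g (v ⊓ t) + #≤ (o + v) step                        ≡⟨ last-step (t <? v) ⟩
  g (v ⊓ suc t)                                      ∎
  where
  open ≡-Reasoning
  step = replicate (g (suc t) ∸ g t) (o + suc t)
  mono′ : ∀ s → s < t → g s ≤ g (suc s)
  mono′ s s<t = mono s (m<n⇒m<1+n s<t)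
  last-step : Dec (t < v) → g (v ⊓ t) + #≤ (o + v) step ≡ g (v ⊓ suc t)
  last-step (yes t<v) = begin
    g (v ⊓ t) + #≤ (o + v) step
      ≡⟨ cong₂ _+_ (cong g (m≥n⇒m⊓n≡n (<⇒≤ t<v))) (#≤-replicate-≤ (g (suc t) ∸ g t) (+-monoʳ-≤ o t<v)) ⟩
    g t + (g (suc t) ∸ g t)          ≡⟨ m+[n∸m]≡n (mono t ≤-refl) ⟩
    g (suc t)                        ≡⟨ cong g (sym (m≥n⇒m⊓n≡n t<v)) ⟩
    g (v ⊓ suc t)                    ∎
  last-step (no t≮v) = begin
    g (v ⊓ t) + #≤ (o + v) step
      ≡⟨ cong (g (v ⊓ t) +_) (#≤-replicate-≰ (g (suc t) ∸ g t) (t≮v ∘′ +-cancelˡ-≤ o _ _)) ⟩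
    g (v ⊓ t) + 0                    ≡⟨ +-identityʳ _ ⟩
    g (v ⊓ t)
      ≡⟨ cong g (trans (m≤n⇒m⊓n≡m (≮⇒≥ t≮v)) (sym (m≤n⇒m⊓n≡m (m≤n⇒m≤1+n (≮⇒≥ t≮v))))) ⟩
    g (v ⊓ suc t)                    ∎

concat-applyUpTo≡staircase : ∀ g o t (c : ℕ → ℕ) → (∀ k → k < t → c k ≡ g (suc k) ∸ g k) →
  concat (applyUpTo (λ k → replicate (c k) (o + suc k)) t) ≡ staircase g o t
concat-applyUpTo≡staircase g o zero    c c≡ = refl
concat-applyUpTo≡staircase g o (suc t) c c≡ = begin
  concat (applyUpTo block (suc t))            ≡⟨ cong concat (sym (applyUpTo-∷ʳ block t)) ⟩
  concat (applyUpTo block t ++ [ block t ])   ≡⟨ sym (concat-++ (applyUpTo block t) [ block t ]) ⟩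
  concat (applyUpTo block t) ++ block t ++ []
    ≡⟨ cong₂ _++_ (concat-applyUpTo≡staircase g o t c c≡′) (++-identityʳ (block t)) ⟩
  staircase g o t ++ block t                  ≡⟨ cong (λ k → staircase g o t ++ replicate k (o + suc t)) (c≡ t ≤-refl) ⟩
  staircase g o (suc t)                       ∎
  where
  open ≡-Reasoning
  block = λ k → replicate (c k) (o + suc k)
  c≡′ : ∀ k → k < t → c k ≡ g (suc k) ∸ g k
  c≡′ k k<t = c≡ k (m<n⇒m<1+n k<t)

∑< : ℕ → (ℕ → ℕ) → ℕ
∑< zero    f = 0
∑< (suc m) f = f 0 + ∑< m (f ∘′ suc)

syntax ∑< m (λ i → e) = ∑[ i < m ] e

∑<-cong : ∀ m {f g : ℕ → ℕ} → (∀ i → i < m → f i ≡ g i) → ∑< m f ≡ ∑< m g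
∑<-cong zero    _   = refl
∑<-cong (suc m) f≡g = cong₂ _+_ (f≡g 0 (s≤s z≤n)) (∑<-cong m (λ i i<m → f≡g (suc i) (s≤s i<m)))

∑<-+ : ∀ m (f g : ℕ → ℕ) → ∑[ i < m ] (f i + g i) ≡ ∑< m f + ∑< m g
∑<-+ zero    f g = refl
∑<-+ (suc m) f g = trans (cong (f 0 + g 0 +_) (∑<-+ m (f ∘′ suc) (g ∘′ suc)))
                         (interchange (f 0) (g 0) (∑< m (f ∘′ suc)) (∑< m (g ∘′ suc)))

∑<-split : ∀ a b (g : ℕ → ℕ) → ∑< (a + b) g ≡ ∑< a g + ∑[ i < b ] g (a + i)
∑<-split zero    b g = refl
∑<-split (suc a) b g = trans (cong (g 0 +_) (∑<-split a b (g ∘′ suc))) (sym (+-assoc (g 0) _ _))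

∑<-snoc : ∀ m (g : ℕ → ℕ) → ∑< (suc m) g ≡ ∑< m g + g m
∑<-snoc m g = begin
  ∑< (suc m) g                     ≡⟨ cong (λ k → ∑< k g) (+-comm 1 m) ⟩
  ∑< (m + 1) g                     ≡⟨ ∑<-split m 1 g ⟩
  ∑< m g + (g (m + 0) + 0)         ≡⟨ cong (∑< m g +_) (trans (+-identityʳ _) (cong g (+-identityʳ m))) ⟩
  ∑< m g + g m                     ∎
  where open ≡-Reasoning

∑<-const : ∀ m c → ∑[ i < m ] c ≡ m * c
∑<-const zero    c = refl
∑<-const (suc m) c = cong (c +_) (∑<-const m c)

∑<-zero : ∀ m (g : ℕ → ℕ) → (∀ i → i < m → g i ≡ 0) → ∑< m g ≡ 0
∑<-zero m g g≡0 = trans (∑<-cong m g≡0) (trans (∑<-const m 0) (*-zeroʳ m))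

∑<-vanishing-tail : ∀ {t m} (g : ℕ → ℕ) → t ≤ m → (∀ j → t ≤ j → g j ≡ 0) → ∑< m g ≡ ∑< t g
∑<-vanishing-tail {t} {m} g t≤m tail≡0 = begin
  ∑< m g                                  ≡⟨ cong (λ k → ∑< k g) (sym (m+[n∸m]≡n t≤m)) ⟩
  ∑< (t + (m ∸ t)) g                      ≡⟨ ∑<-split t (m ∸ t) g ⟩
  ∑< t g + ∑[ j < m ∸ t ] g (t + j)
    ≡⟨ cong (∑< t g +_) (∑<-zero (m ∸ t) _ (λ j _ → tail≡0 (t + j) (m≤m+n t j))) ⟩
  ∑< t g + 0                              ≡⟨ +-identityʳ _ ⟩
  ∑< t g                                  ∎
  where open ≡-Reasoning

∑<-term : ∀ m (g : ℕ → ℕ) i → i < m → g i ≤ ∑< m g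
∑<-term (suc m) g zero    _         = m≤m+n _ _
∑<-term (suc m) g (suc i) (s≤s i<m) = ≤-trans (∑<-term m (g ∘′ suc) i i<m) (m≤n+m _ _)

∑<-mono : ∀ m {f g : ℕ → ℕ} → (∀ i → i < m → f i ≤ g i) → ∑< m f ≤ ∑< m g
∑<-mono zero    _   = z≤n
∑<-mono (suc m) f≤g = +-mono-≤ (f≤g 0 (s≤s z≤n)) (∑<-mono m (λ i i<m → f≤g (suc i) (s≤s i<m)))

∑<-≡-termwise : ∀ m {f g : ℕ → ℕ} → (∀ i → i < m → f i ≤ g i) → ∑< m f ≡ ∑< m g →
  ∀ i → i < m → f i ≡ g i
∑<-≡-termwise (suc m) {f} {g} f≤g sum≡ = termwise
  where
  f≤g′ : ∀ i → i < m → f (suc i) ≤ g (suc i)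
  f≤g′ i i<m = f≤g (suc i) (s≤s i<m)
  head≡ : f 0 ≡ g 0
  head≡ = ≤-antisym (f≤g 0 (s≤s z≤n))
    (+-cancelʳ-≤ (∑< m (f ∘′ suc)) (g 0) (f 0)
      (≤-trans (+-monoʳ-≤ (g 0) (∑<-mono m f≤g′)) (≤-reflexive (sym sum≡))))
  tail≡ : ∑< m (f ∘′ suc) ≡ ∑< m (g ∘′ suc)
  tail≡ = +-cancelˡ-≡ (f 0) _ _ (trans sum≡ (cong (_+ ∑< m (g ∘′ suc)) (sym head≡)))
  termwise : ∀ i → i < suc m → f i ≡ g i
  termwise zero    _         = head≡
  termwise (suc i) (s≤s i<m) = ∑<-≡-termwise m f≤g′ tail≡ i i<m

∑<-part : ∀ {n} (α : Vec ℕ n) → ∑[ k < n ] part α (suc k) ≡ Vec.sum α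
∑<-part Vec.[]       = refl
∑<-part (a Vec.∷ α) = cong (a +_) (∑<-part α)

-- Tableaux as lists of rows

row : ∀ {m} → Tableau m → ℕ → List ℕ
row X i = rowAt (Vec.toList X) i

lookup≡row : ∀ {m} (X : Tableau m) (r : Fin m) → Vec.lookup X r ≡ row X (toℕ r)
lookup≡row (x Vec.∷ X) Fin.zero    = refl
lookup≡row (x Vec.∷ X) (Fin.suc r) = lookup≡row X r

lookup-fromℕ< : ∀ {m} (X : Tableau m) {i} (i<m : i < m) → Vec.lookup X (fromℕ< i<m) ≡ row X i
lookup-fromℕ< X i<m = trans (lookup≡row X (fromℕ< i<m)) (cong (row X) (toℕ-fromℕ< i<m))

row-beyond : ∀ {m} (X : Tableau m) i → m ≤ i → row X i ≡ []
row-beyond Vec.[]      i       _         = refl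
row-beyond (x Vec.∷ X) (suc i) (s≤s m≤i) = row-beyond X i m≤i

row-ext : ∀ {m} (X Y : Tableau m) → (∀ i → i < m → row X i ≡ row Y i) → X ≡ Y
row-ext Vec.[]      Vec.[]      _  = refl
row-ext (x Vec.∷ X) (y Vec.∷ Y) eq = cong₂ Vec._∷_ (eq 0 (s≤s z≤n)) (row-ext X Y (λ i i<m → eq (suc i) (s≤s i<m)))

row-map : ∀ {m} (f : List ℕ → List ℕ) → f [] ≡ [] → (X : Tableau m) → ∀ i → row (Vec.map f X) i ≡ f (row X i)
row-map f f[] Vec.[]      i       = sym f[]
row-map f f[] (x Vec.∷ X) zero    = refl
row-map f f[] (x Vec.∷ X) (suc i) = row-map f f[] X i

row-tabulate : ∀ {m} (g : ℕ → List ℕ) i → i < m → row {m} (Vec.tabulate (g ∘′ toℕ)) i ≡ g i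
row-tabulate g i i<m = trans (sym (lookup-fromℕ< (Vec.tabulate (g ∘′ toℕ)) i<m))
  (trans (lookup∘tabulate (g ∘′ toℕ) (fromℕ< i<m)) (cong g (toℕ-fromℕ< i<m)))

map-length-≡ : ∀ {m} (X Y : Tableau m) →
  (∀ i → i < m → length (row X i) ≡ length (row Y i)) → Vec.map length X ≡ Vec.map length Y
map-length-≡ Vec.[]      Vec.[]      _  = refl
map-length-≡ (x Vec.∷ X) (y Vec.∷ Y) eq =
  cong₂ Vec._∷_ (eq 0 (s≤s z≤n)) (map-length-≡ X Y (λ i i<m → eq (suc i) (s≤s i<m)))

map-length-≡⁻ : ∀ {m} (X Y : Tableau m) →
  Vec.map length X ≡ Vec.map length Y → ∀ i → length (row X i) ≡ length (row Y i)
map-length-≡⁻ Vec.[]      Vec.[]      _  i       = refl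
map-length-≡⁻ (x Vec.∷ X) (y Vec.∷ Y) eq zero    = cong Vec.head eq
map-length-≡⁻ (x Vec.∷ X) (y Vec.∷ Y) eq (suc i) = map-length-≡⁻ X Y (cong Vec.tail eq) i

#≤ᵗ : ∀ {m} → ℕ → Tableau m → ℕ
#≤ᵗ {m} v X = ∑[ i < m ] #≤ v (row X i)

count≡∑ : ∀ {m} k (X : Tableau m) → count k X ≡ ∑[ i < m ] #≡ k (row X i)
count≡∑ k Vec.[]      = refl
count≡∑ k (x Vec.∷ X) = cong (#≡ k x +_) (count≡∑ k X)

count-0 : ∀ {m} (X : Tableau m) → count 0 X ≡ #≤ᵗ 0 X
count-0 {m} X = trans (count≡∑ 0 X) (∑<-cong m (λ i _ → sym (#≤0≡#≡0 (row X i))))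

count-suc : ∀ {m} k (X : Tableau m) → #≤ᵗ k X + count (suc k) X ≡ #≤ᵗ (suc k) X
count-suc {m} k X = begin
  #≤ᵗ k X + count (suc k) X                                   ≡⟨ cong (#≤ᵗ k X +_) (count≡∑ (suc k) X) ⟩
  #≤ᵗ k X + ∑[ i < m ] #≡ (suc k) (row X i)                   ≡⟨ sym (∑<-+ m _ _) ⟩
  ∑[ i < m ] (#≤ k (row X i) + #≡ (suc k) (row X i))          ≡⟨ ∑<-cong m (λ i _ → sym (#≤-suc k (row X i))) ⟩
  #≤ᵗ (suc k) X                                               ∎
  where open ≡-Reasoning

count-suc-≡ : ∀ {m} k (X : Tableau m) {c} → #≤ᵗ k X + c ≡ #≤ᵗ (suc k) X → count (suc k) X ≡ c
count-suc-≡ k X eq = +-cancelˡ-≡ (#≤ᵗ k X) _ _ (trans (count-suc k X) (sym eq))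

#≤ᵗ-telescope : ∀ {m} (X : Tableau m) v → #≤ᵗ v X ≡ count 0 X + ∑[ k < v ] count (suc k) X
#≤ᵗ-telescope X zero    = sym (trans (+-identityʳ _) (count-0 X))
#≤ᵗ-telescope X (suc v) = begin
  #≤ᵗ (suc v) X                                              ≡⟨ sym (count-suc v X) ⟩
  #≤ᵗ v X + count (suc v) X                                  ≡⟨ cong (_+ count (suc v) X) (#≤ᵗ-telescope X v) ⟩
  count 0 X + ∑[ k < v ] count (suc k) X + count (suc v) X   ≡⟨ +-assoc (count 0 X) _ _ ⟩
  count 0 X + (∑[ k < v ] count (suc k) X + count (suc v) X) ≡⟨ cong (count 0 X +_) (sym (∑<-snoc v _)) ⟩
  count 0 X + ∑[ k < suc v ] count (suc k) X                 ∎
  where open ≡-Reasoning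

count-beyond : ∀ {m} (X : Tableau m) {l} → (∀ i → All (_≤ l) (row X i)) → ∀ k → l ≤ k → count (suc k) X ≡ 0
count-beyond {m} X X≤l k l≤k = count-suc-≡ k X (trans (+-identityʳ _) (∑<-cong m full))
  where
  full : ∀ i → i < m → #≤ k (row X i) ≡ #≤ (suc k) (row X i)
  full i _ = trans (#≤-all (row X i) (All.map (λ x≤l → ≤-trans x≤l l≤k) (X≤l i)))
                   (sym (#≤-all (row X i) (All.map (λ x≤l → ≤-trans x≤l (m≤n⇒m≤1+n l≤k)) (X≤l i))))

#≤ᵗ-total : ∀ {m l} (X : Tableau m) (γ : Vec ℕ l) → HasType X γ → #≤ᵗ l X ≡ Vec.sum γ
#≤ᵗ-total {l = l} X γ type = begin
  #≤ᵗ l X                                        ≡⟨ #≤ᵗ-telescope X l ⟩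
  count 0 X + ∑[ k < l ] count (suc k) X         ≡⟨ cong₂ _+_ (type 0) (∑<-cong l (λ k _ → type (suc k))) ⟩
  ∑[ k < l ] part γ (suc k)                      ≡⟨ ∑<-part γ ⟩
  Vec.sum γ                                      ∎
  where open ≡-Reasoning

All-row-from-count : ∀ {m} (X : Tableau m) {P : ℕ → Set} → (∀ k → 0 < count k X → P k) → ∀ i → All P (row X i)
All-row-from-count {m} X h i with i <? m
... | yes i<m = All-from-#≡ (row X i) (λ k k-occurs → h k (<-≤-trans k-occurs (#≡-row≤count k i<m)))
  where
  #≡-row≤count : ∀ k → i < m → #≡ k (row X i) ≤ count k X
  #≡-row≤count k i<m = ≤-trans (∑<-term m (λ i → #≡ k (row X i)) i i<m) (≤-reflexive (sym (count≡∑ k X)))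
... | no i≮m rewrite row-beyond X i (≮⇒≥ i≮m) = []

part-beyond : ∀ {l} (γ : Vec ℕ l) k → l < k → part γ k ≡ 0
part-beyond γ (suc k) (s≤s l≤k) = at-beyond (Vec.toList γ) k (≤-trans (≤-reflexive (length-toList γ)) l≤k)
  where
  at-beyond : ∀ xs k → length xs ≤ k → at xs k ≡ 0
  at-beyond []       k       _         = refl
  at-beyond (x ∷ xs) (suc k) (s≤s l≤k) = at-beyond xs k l≤k

HasType⇒entries-in-range : ∀ {m l} (X : Tableau m) (γ : Vec ℕ l) → HasType X γ →
  ∀ i → All (λ x → 0 < x × x ≤ l) (row X i)
HasType⇒entries-in-range {l = l} X γ type = All-row-from-count X occurring
  where
  occurring : ∀ k → 0 < count k X → 0 < k × k ≤ l
  occurring zero    0<c = ⊥-elim (<⇒≢ 0<c (sym (type 0)))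
  occurring (suc k) 0<c with suc k ≤? l
  ... | yes k<l = s≤s z≤n , k<l
  ... | no k≰l  = ⊥-elim (<⇒≢ 0<c (sym (trans (type (suc k)) (part-beyond γ (suc k) (≰⇒> k≰l)))))

-- Semistandardness in terms of counting functions

record CountingSSYT {m} (X : Tableau m) : Set where
  field
    sorted    : ∀ i → Sorted (row X i)
    shifted   : ∀ i → Shifted (row X i) (row X (suc i))
    shrinking : ∀ i → length (row X (suc i)) ≤ length (row X i)

  #≤-antitone : ∀ i v → #≤ v (row X (suc i)) ≤ #≤ v (row X i)
  #≤-antitone i v = ≤-trans (#≤-mono (row X (suc i)) (n≤1+n v)) (shifted i v)

  #≤-below-diagonal : #≤ 0 (row X 0) ≡ 0 → ∀ i v → v ≤ i → #≤ v (row X i) ≡ 0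
  #≤-below-diagonal no-zero zero    zero    _         = no-zero
  #≤-below-diagonal no-zero (suc i) zero    _         = n≤0⇒n≡0
    (≤-trans (#≤-antitone i 0) (≤-reflexive (#≤-below-diagonal no-zero i 0 z≤n)))
  #≤-below-diagonal no-zero (suc i) (suc v) (s≤s v≤i) = n≤0⇒n≡0
    (≤-trans (shifted i v) (≤-reflexive (#≤-below-diagonal no-zero i v v≤i)))

module _ {m} (X : Tableau m) where

  IsSSYT⇒CountingSSYT : IsSSYT X → CountingSSYT X
  IsSSYT⇒CountingSSYT ssyt = record { sorted = sorted ; shifted = shifted ; shrinking = shrinking }
    where
    open IsSSYT ssyt
    sorted : ∀ i → Sorted (row X i)
    sorted i with i <? m
    ... | yes i<m = subst Sorted (lookup-fromℕ< X i<m) (Linked⇒AllPairs ≤-trans (rowsWeak (fromℕ< i<m)))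
    ... | no i≮m rewrite row-beyond X i (≮⇒≥ i≮m) = []
    shrinking : ∀ i → length (row X (suc i)) ≤ length (row X i)
    shrinking i with suc i <? m
    ... | yes i+1<m = subst₂ _≤_ (cong length (lookup-fromℕ< X i+1<m)) (cong length (lookup-fromℕ< X i<m))
          (shapeDecr (fromℕ< i<m) (fromℕ< i+1<m)
            (subst₂ _≤_ (sym (toℕ-fromℕ< i<m)) (sym (toℕ-fromℕ< i+1<m)) (n≤1+n i)))
      where i<m = <-trans (n<1+n i) i+1<m
    ... | no i+1≮m rewrite row-beyond X (suc i) (≮⇒≥ i+1≮m) = z≤n
    shifted : ∀ i → Shifted (row X i) (row X (suc i))
    shifted i with suc i <? m
    ... | yes i+1<m = columnStrict⇒shifted _ _ (sorted i) (sorted (suc i)) (shrinking i) columnStrict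
      where
      i<m = <-trans (n<1+n i) i+1<m
      columnStrict : ColumnStrict (row X i) (row X (suc i))
      columnStrict j j<l = subst₂ (λ a b → at a j < at b j) (lookup-fromℕ< X i<m) (lookup-fromℕ< X i+1<m)
        (colsStrict (fromℕ< i<m) (fromℕ< i+1<m) j
          (subst₂ _<_ (sym (toℕ-fromℕ< i<m)) (sym (toℕ-fromℕ< i+1<m)) (n<1+n i))
          (subst (λ r → j < length r) (sym (lookup-fromℕ< X i+1<m)) j<l))
    ... | no i+1≮m rewrite row-beyond X (suc i) (≮⇒≥ i+1≮m) = λ _ → z≤n

  CountingSSYT⇒IsSSYT : CountingSSYT X → #≤ 0 (row X 0) ≡ 0 → IsSSYT X
  CountingSSYT⇒IsSSYT cssyt no-zero =
    record { shapeDecr = shapeDecr ; rowsWeak = rowsWeak ; colsStrict = colsStrict }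
    where
    open CountingSSYT cssyt
    shrinking⁺ : ∀ g i → length (row X (g + i)) ≤ length (row X i)
    shrinking⁺ zero    i = ≤-refl
    shrinking⁺ (suc g) i = ≤-trans (shrinking (g + i)) (shrinking⁺ g i)
    strict : ∀ i → ColumnStrict (row X i) (row X (suc i))
    strict i = shifted⇒columnStrict _ _ (sorted i) (sorted (suc i)) (shifted i)
                 (#≤-below-diagonal no-zero (suc i) 0 z≤n)
    strict⁺ : ∀ g i → ColumnStrict (row X i) (row X (suc g + i))
    strict⁺ zero    i j j<l = strict i j j<l
    strict⁺ (suc g) i j j<l = <-trans (strict⁺ g i j (<-≤-trans j<l (shrinking (suc g + i)))) (strict (suc g + i) j j<l)
    shapeDecr : ∀ (r₁ r₂ : Fin m) → toℕ r₁ ≤ toℕ r₂ → length (Vec.lookup X r₂) ≤ length (Vec.lookup X r₁)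
    shapeDecr r₁ r₂ r₁≤r₂ rewrite lookup≡row X r₁ | lookup≡row X r₂ =
      subst (λ a → length (row X a) ≤ length (row X (toℕ r₁))) (m∸n+n≡m r₁≤r₂)
        (shrinking⁺ (toℕ r₂ ∸ toℕ r₁) (toℕ r₁))
    rowsWeak : ∀ r → Linked _≤_ (Vec.lookup X r)
    rowsWeak r rewrite lookup≡row X r = AllPairs⇒Linked (sorted (toℕ r))
    colsStrict : ∀ (r₁ r₂ : Fin m) j → toℕ r₁ < toℕ r₂ → j < length (Vec.lookup X r₂) →
                 at (Vec.lookup X r₁) j < at (Vec.lookup X r₂) j
    colsStrict r₁ r₂ j r₁<r₂ rewrite lookup≡row X r₁ | lookup≡row X r₂ =
      subst (λ a → j < length (row X a) → at (row X (toℕ r₁)) j < at (row X a) j)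
        (trans (sym (+-suc _ (toℕ r₁))) (m∸n+n≡m r₁<r₂)) (strict⁺ (toℕ r₂ ∸ suc (toℕ r₁)) (toℕ r₁) j)

at-++ˡ : ∀ xs ys k → k < length xs → at (xs ++ ys) k ≡ at xs k
at-++ˡ (x ∷ xs) ys zero    _         = refl
at-++ˡ (x ∷ xs) ys (suc k) (s≤s k<l) = at-++ˡ xs ys k k<l

at-++ʳ : ∀ xs ys k → at (xs ++ ys) (length xs + k) ≡ at ys k
at-++ʳ []       ys k = refl
at-++ʳ (x ∷ xs) ys k = at-++ʳ xs ys k

at-map : ∀ (f : ℕ → ℕ) xs k → k < length xs → at (List.map f xs) k ≡ f (at xs k)
at-map f (x ∷ xs) zero    _         = refl
at-map f (x ∷ xs) (suc k) (s≤s k<l) = at-map f xs k k<l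

at-reverse : ∀ xs k → k < length xs → at (List.reverse xs) k ≡ at xs (length xs ∸ suc k)
at-reverse (x ∷ xs) k k<l rewrite unfold-reverse x xs with m≤n⇒m<n∨m≡n (≤-pred k<l)
... | inj₁ k<l′ = begin
  at (List.reverse xs ++ [ x ]) k   ≡⟨ at-++ˡ (List.reverse xs) [ x ] k (subst (k <_) (sym (length-reverse xs)) k<l′) ⟩
  at (List.reverse xs) k            ≡⟨ at-reverse xs k k<l′ ⟩
  at xs (length xs ∸ suc k)         ≡⟨ cong (at (x ∷ xs)) (sym (∸-suc k<l′)) ⟩
  at (x ∷ xs) (length xs ∸ k)       ∎
  where open ≡-Reasoning
... | inj₂ refl = begin
  at (List.reverse xs ++ [ x ]) (length xs)                  ≡⟨ cong (at (List.reverse xs ++ [ x ])) (sym last) ⟩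
  at (List.reverse xs ++ [ x ]) (length (List.reverse xs) + 0) ≡⟨ at-++ʳ (List.reverse xs) [ x ] 0 ⟩
  x                                                          ≡⟨ cong (at (x ∷ xs)) (sym (n∸n≡0 (length xs))) ⟩
  at (x ∷ xs) (length xs ∸ length xs)                        ∎
  where
  open ≡-Reasoning
  last : length (List.reverse xs) + 0 ≡ length xs
  last = trans (+-identityʳ _) (length-reverse xs)

module _ {n m} (d : ℕ) (α : Vec ℕ n) (β : Vec ℕ m) where

  part-TType-α : ∀ k → k < n → part (TType d α β) (suc k) ≡ part α (suc k)
  part-TType-α k k<n = trans (cong (λ xs → at xs k) (toList-++ α _))
    (at-++ˡ (Vec.toList α) _ k (subst (k <_) (sym (length-toList α)) k<n))

  part-TType-β : ∀ K → K < m → part (TType d α β) (suc (n + K)) ≡ d ∸ part β (m ∸ K)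
  part-TType-β K K<m = begin
    at (Vec.toList (α Vec.++ Vec.reverse (Vec.map (d ∸_) β))) (n + K)
      ≡⟨ cong (λ xs → at xs (n + K)) (toList-++ α _) ⟩
    at (Vec.toList α ++ Vec.toList (Vec.reverse (Vec.map (d ∸_) β))) (n + K)
      ≡⟨ cong (λ l → at (Vec.toList α ++ _) (l + K)) (sym (length-toList α)) ⟩
    at (Vec.toList α ++ Vec.toList (Vec.reverse (Vec.map (d ∸_) β))) (length (Vec.toList α) + K)
      ≡⟨ at-++ʳ (Vec.toList α) _ K ⟩
    at (Vec.toList (Vec.reverse (Vec.map (d ∸_) β))) K
      ≡⟨ cong (λ xs → at xs K) (trans (toList-reverse (Vec.map (d ∸_) β)) (cong List.reverse (toList-map (d ∸_) β))) ⟩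
    at (List.reverse (List.map (d ∸_) βs)) K
      ≡⟨ at-reverse (List.map (d ∸_) βs) K (subst (K <_) (sym length-dβ) K<m) ⟩
    at (List.map (d ∸_) βs) (length (List.map (d ∸_) βs) ∸ suc K)
      ≡⟨ cong (λ l → at (List.map (d ∸_) βs) (l ∸ suc K)) length-dβ ⟩
    at (List.map (d ∸_) βs) (m ∸ suc K)
      ≡⟨ at-map (d ∸_) βs (m ∸ suc K) (subst (m ∸ suc K <_) (sym (length-toList β)) m-K-1<m) ⟩
    d ∸ at βs (m ∸ suc K)
      ≡⟨ cong (λ k → d ∸ part β k) (sym (∸-suc K<m)) ⟩
    d ∸ part β (m ∸ K) ∎
    where
    open ≡-Reasoning
    βs = Vec.toList β
    length-dβ : length (List.map (d ∸_) βs) ≡ m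
    length-dβ = trans (length-map (d ∸_) βs) (length-toList β)
    m-K-1<m : m ∸ suc K < m
    m-K-1<m = subst (_≤ m) (∸-suc K<m) (m∸n≤m m K)

  part-TType-beyond : ∀ K → m ≤ K → part (TType d α β) (suc (n + K)) ≡ 0
  part-TType-beyond K m≤K = part-beyond (TType d α β) (suc (n + K)) (s≤s (+-monoʳ-≤ n m≤K))

-- The rows of θ(P, Q)

lam-mono : ∀ {m} d (Q : Tableau m) j {t t′} → t ≤ t′ → lam d Q j t ≤ lam d Q j t′
lam-mono d Q zero    _    = ≤-refl
lam-mono d Q (suc j) t≤t′ = #≤-mono (row Q j) t≤t′

-- What is needed of (P, Q) to compute θ(P, Q) row by row; it holds on 𝔖_d(α,β) and for the
-- preimage built from a tableau in 𝔗_d(α,β).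
record Compatible (d n : ℕ) {m} (P Q : Tableau m) : Set where
  field
    P-sorted  : ∀ i → Sorted (row P i)
    P-bounded : ∀ i → All (_≤ n) (row P i)
    length-P  : ∀ i → length (row P i) ≡ #≤ m (row Q i)
    λ-chain   : ∀ j t → lam d Q (suc j) (suc t) ≤ lam d Q j t
    Q-above   : ∀ i v → v ≤ i → #≤ v (row Q i) ≡ 0

module θ-Rows {d n m} {P Q : Tableau m} (compatible : Compatible d n P Q) where
  open Compatible compatible

  θ : Tableau m
  θ = theta d n P Q

  -- Λ I K = λ_{I-K}(m-K) is the number of entries ≤ n + K in row I (1-based) of θ.
  Λ : ℕ → ℕ → ℕ
  Λ I K = lam d Q (I ∸ K) (m ∸ K)

  Λ-beyond : ∀ I K → I ≤ K → Λ I K ≡ d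
  Λ-beyond I K I≤K rewrite m≤n⇒m∸n≡0 I≤K = refl

  Λ-step : ∀ I K → Λ (suc I) (suc K) ≤ Λ I K
  Λ-step I K = lam-mono d Q (I ∸ K) (∸-monoʳ-≤ m (n≤1+n K))

  Λ-mono : ∀ {I} → I ≤ m → ∀ k → k < I → Λ I k ≤ Λ I (suc k)
  Λ-mono {I} I≤m k k<I = subst₂ (λ a b → lam d Q a b ≤ Λ I (suc k)) (sym (∸-suc k<I)) (sym (∸-suc (<-≤-trans k<I I≤m)))
    (λ-chain _ _)

  row-θ : ∀ i → i < m → row θ i ≡ row P i ++ staircase (Λ (suc i)) n (suc i)
  row-θ i i<m = begin
    row θ i                                   ≡⟨ sym (lookup-fromℕ< θ i<m) ⟩
    Vec.lookup θ (fromℕ< i<m)                 ≡⟨ lookup∘tabulate _ (fromℕ< i<m) ⟩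
    Vec.lookup P (fromℕ< i<m) ++ steps (toℕ (fromℕ< i<m))
      ≡⟨ cong₂ (λ r k → r ++ steps k) (lookup-fromℕ< P i<m) (toℕ-fromℕ< i<m) ⟩
    row P i ++ steps i                        ≡⟨ cong (row P i ++_) (concat-applyUpTo≡staircase _ n (suc i) _ step-sizes) ⟩
    row P i ++ staircase (Λ (suc i)) n (suc i) ∎
    where
    open ≡-Reasoning
    steps : ℕ → List ℕ
    steps i = concat (applyUpTo (λ k → replicate (Λ (suc i) (suc k) ∸ lam d Q (suc i ∸ suc k + 1) (m ∸ suc k + 1))
                                                 (n + suc k))
                                (suc i))
    shift : ∀ {k I} → k < I → I ∸ suc k + 1 ≡ I ∸ k
    shift k<I = trans (+-comm _ 1) (sym (∸-suc k<I))
    step-sizes : ∀ k → k < suc i →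
      Λ (suc i) (suc k) ∸ lam d Q (suc i ∸ suc k + 1) (m ∸ suc k + 1) ≡ Λ (suc i) (suc k) ∸ Λ (suc i) k
    step-sizes k k<I = cong₂ (λ a b → Λ (suc i) (suc k) ∸ lam d Q a b) (shift k<I) (shift (<-≤-trans k<I i<m))

  module _ (i : ℕ) (i<m : i < m) where
    private
      I = suc i
      stairs = staircase (Λ I) n I

    θ-row-sorted : Sorted (row θ i)
    θ-row-sorted = subst Sorted (sym (row-θ i i<m))
      (AllPairs.++⁺ (P-sorted i) (staircase-sorted _ n I)
        (All.map (λ x≤n → All.map (λ (n<y , _) → ≤-trans x≤n (<⇒≤ n<y)) (staircase-bounded _ n I)) (P-bounded i)))

    #≤-θ-low : ∀ v → v ≤ n → #≤ v (row θ i) ≡ #≤ v (row P i)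
    #≤-θ-low v v≤n = begin
      #≤ v (row θ i)                  ≡⟨ cong (#≤ v) (row-θ i i<m) ⟩
      #≤ v (row P i ++ stairs)        ≡⟨ #≤-++ v (row P i) stairs ⟩
      #≤ v (row P i) + #≤ v stairs    ≡⟨ cong (#≤ v (row P i) +_) (#≤-staircase-low _ n I v≤n) ⟩
      #≤ v (row P i) + 0              ≡⟨ +-identityʳ _ ⟩
      #≤ v (row P i)                  ∎
      where open ≡-Reasoning

    #≤-θ-high : ∀ K → #≤ (n + K) (row θ i) ≡ Λ I K
    #≤-θ-high K = begin
      #≤ (n + K) (row θ i)                         ≡⟨ cong (#≤ (n + K)) (row-θ i i<m) ⟩
      #≤ (n + K) (row P i ++ stairs)               ≡⟨ #≤-++ (n + K) (row P i) stairs ⟩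
      #≤ (n + K) (row P i) + #≤ (n + K) stairs     ≡⟨ cong (_+ #≤ (n + K) stairs) P-below ⟩
      Λ I 0 + #≤ (n + K) stairs                    ≡⟨ #≤-staircase (Λ I) n I (Λ-mono i<m) K ⟩
      Λ I (K ⊓ I)                                  ≡⟨ Λ-⊓ (K ≤? I) ⟩
      Λ I K                                        ∎
      where
      open ≡-Reasoning
      P-below : #≤ (n + K) (row P i) ≡ Λ I 0
      P-below = trans (#≤-all (row P i) (All.map (λ x≤n → ≤-trans x≤n (m≤m+n n K)) (P-bounded i))) (length-P i)
      Λ-⊓ : Dec (K ≤ I) → Λ I (K ⊓ I) ≡ Λ I K
      Λ-⊓ (yes K≤I) = cong (Λ I) (m≤n⇒m⊓n≡m K≤I)
      Λ-⊓ (no K≰I)  = trans (cong (Λ I) (m≥n⇒m⊓n≡n I≤K)) (trans (Λ-beyond I I ≤-refl) (sym (Λ-beyond I K I≤K)))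
        where I≤K = <⇒≤ (≰⇒> K≰I)

    θ-row-length : length (row θ i) ≡ d
    θ-row-length = trans (sym (#≤-all (row θ i) bounded)) (trans (#≤-θ-high I) (Λ-beyond I I ≤-refl))
      where
      bounded : All (_≤ n + I) (row θ i)
      bounded = subst (All (_≤ n + I)) (sym (row-θ i i<m))
        (All.++⁺ (All.map (λ x≤n → ≤-trans x≤n (m≤m+n n I)) (P-bounded i)) (All.map proj₂ (staircase-bounded _ n I)))

  #≤ᵗ-θ-low : ∀ v → v ≤ n → #≤ᵗ v θ ≡ #≤ᵗ v P
  #≤ᵗ-θ-low v v≤n = ∑<-cong m (λ i i<m → #≤-θ-low i i<m v v≤n)

  #≤ᵗ-θ-high : ∀ K → K ≤ m → #≤ᵗ (n + K) θ ≡ K * d + #≤ᵗ (m ∸ K) Q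
  #≤ᵗ-θ-high K K≤m = begin
    #≤ᵗ (n + K) θ                                     ≡⟨ ∑<-cong m (λ i i<m → #≤-θ-high i i<m K) ⟩
    ∑[ i < m ] Λ (suc i) K
      ≡⟨ cong (λ k → ∑< k (λ i → Λ (suc i) K)) (sym (m+[n∸m]≡n K≤m)) ⟩
    ∑[ i < K + t ] Λ (suc i) K                        ≡⟨ ∑<-split K t (λ i → Λ (suc i) K) ⟩
    ∑[ i < K ] Λ (suc i) K + ∑[ j < t ] Λ (suc (K + j)) K
      ≡⟨ cong₂ _+_ (trans (∑<-cong K (λ i i<K → Λ-beyond (suc i) K i<K)) (∑<-const K d))
                   (∑<-cong t (λ j _ → cong (λ a → lam d Q a t) (1+[m+n]∸m≡1+n K j))) ⟩
    K * d + ∑[ j < t ] #≤ t (row Q j)                 ≡⟨ cong (K * d +_) (sym Q-truncated) ⟩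
    K * d + #≤ᵗ t Q                                   ∎
    where
    open ≡-Reasoning
    t = m ∸ K
    Q-truncated : #≤ᵗ t Q ≡ ∑[ j < t ] #≤ t (row Q j)
    Q-truncated = ∑<-vanishing-tail (λ j → #≤ t (row Q j)) (m∸n≤m m K) (λ j t≤j → Q-above j t t≤j)

  #≤ᵗ-θ-full : ∀ K → m ≤ K → #≤ᵗ (n + K) θ ≡ m * d
  #≤ᵗ-θ-full K m≤K = trans (∑<-cong m (λ i i<m → trans (#≤-θ-high i i<m K) (Λ-beyond (suc i) K (≤-trans i<m m≤K))))
                           (∑<-const m d)

module θ-Type {d n m} {P Q : Tableau m} (compatible : Compatible d n P Q) where
  open Compatible compatible
  open θ-Rows compatible

  count-θ-low : ∀ k → k ≤ n → count k θ ≡ count k P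
  count-θ-low zero    _   = trans (count-0 θ) (trans (#≤ᵗ-θ-low 0 z≤n) (sym (count-0 P)))
  count-θ-low (suc k) k<n = count-suc-≡ k θ (begin
    #≤ᵗ k θ + count (suc k) P   ≡⟨ cong (_+ count (suc k) P) (#≤ᵗ-θ-low k (<⇒≤ k<n)) ⟩
    #≤ᵗ k P + count (suc k) P   ≡⟨ count-suc k P ⟩
    #≤ᵗ (suc k) P               ≡⟨ sym (#≤ᵗ-θ-low (suc k) k<n) ⟩
    #≤ᵗ (suc k) θ               ∎)
    where open ≡-Reasoning

  count-θ-high : ∀ K → K < m → count (suc (n + K)) θ + count (m ∸ K) Q ≡ d
  count-θ-high K K<m = +-cancelˡ-≡ (K * d + #≤ᵗ t Q) _ _ (begin
    K * d + #≤ᵗ t Q + (cθ + count (m ∸ K) Q)   ≡⟨ cong (λ k → K * d + #≤ᵗ t Q + (cθ + count k Q)) (∸-suc K<m) ⟩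
    K * d + #≤ᵗ t Q + (cθ + cQ)                ≡⟨ rearrange (K * d) (#≤ᵗ t Q) cθ cQ ⟩
    K * d + (#≤ᵗ t Q + cQ) + cθ                ≡⟨ cong (λ x → K * d + x + cθ) (count-suc t Q) ⟩
    K * d + #≤ᵗ (suc t) Q + cθ                 ≡⟨ cong (λ k → K * d + #≤ᵗ k Q + cθ) (sym (∸-suc K<m)) ⟩
    K * d + #≤ᵗ (m ∸ K) Q + cθ                 ≡⟨ cong (_+ cθ) (sym (#≤ᵗ-θ-high K (<⇒≤ K<m))) ⟩
    #≤ᵗ (n + K) θ + cθ                         ≡⟨ count-suc (n + K) θ ⟩
    #≤ᵗ (suc (n + K)) θ                        ≡⟨ cong (λ k → #≤ᵗ k θ) (sym (+-suc n K)) ⟩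
    #≤ᵗ (n + suc K) θ                          ≡⟨ #≤ᵗ-θ-high (suc K) K<m ⟩
    d + K * d + #≤ᵗ t Q                        ≡⟨ +-comm (d + K * d) _ ⟩
    #≤ᵗ t Q + (d + K * d)                      ≡⟨ rearrange′ (#≤ᵗ t Q) d (K * d) ⟩
    K * d + #≤ᵗ t Q + d                        ∎)
    where
    open ≡-Reasoning
    t  = m ∸ suc K
    cθ = count (suc (n + K)) θ
    cQ = count (suc t) Q
    rearrange : ∀ a b c e → a + b + (c + e) ≡ a + (b + e) + c
    rearrange = solve 4 (λ a b c e → a :+ b :+ (c :+ e) := a :+ (b :+ e) :+ c) refl
    rearrange′ : ∀ b c a → b + (c + a) ≡ a + b + c
    rearrange′ = solve 3 (λ b c a → b :+ (c :+ a) := a :+ b :+ c) refl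

  count-θ-beyond : ∀ K → m ≤ K → count (suc (n + K)) θ ≡ 0
  count-θ-beyond K m≤K = count-suc-≡ (n + K) θ (begin
    #≤ᵗ (n + K) θ + 0         ≡⟨ +-identityʳ _ ⟩
    #≤ᵗ (n + K) θ             ≡⟨ #≤ᵗ-θ-full K m≤K ⟩
    m * d                     ≡⟨ sym (#≤ᵗ-θ-full (suc K) (m≤n⇒m≤1+n m≤K)) ⟩
    #≤ᵗ (n + suc K) θ         ≡⟨ cong (λ k → #≤ᵗ k θ) (+-suc n K) ⟩
    #≤ᵗ (suc (n + K)) θ       ∎)
    where open ≡-Reasoning

-- θ is well defined and injective

module θ-on-S {d n m} {α : Vec ℕ n} {β : Vec ℕ m} {P Q : Tableau m} (pq∈S : InS d α β P Q) where
  private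
    P-ssyt     = proj₁ pq∈S
    Q-ssyt     = proj₁ (proj₂ pq∈S)
    same-shape = proj₁ (proj₂ (proj₂ pq∈S))
    P-width    = proj₁ (proj₂ (proj₂ (proj₂ pq∈S)))
    P-type     = proj₁ (proj₂ (proj₂ (proj₂ (proj₂ pq∈S))))
    Q-type     = proj₂ (proj₂ (proj₂ (proj₂ (proj₂ pq∈S))))

  P-counting : CountingSSYT P
  P-counting = IsSSYT⇒CountingSSYT P P-ssyt

  Q-counting : CountingSSYT Q
  Q-counting = IsSSYT⇒CountingSSYT Q Q-ssyt

  P-range : ∀ i → All (λ x → 0 < x × x ≤ n) (row P i)
  P-range = HasType⇒entries-in-range P α P-type

  Q-range : ∀ i → All (λ x → 0 < x × x ≤ m) (row Q i)
  Q-range = HasType⇒entries-in-range Q β Q-type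

  length-PQ : ∀ i → length (row P i) ≡ length (row Q i)
  length-PQ = map-length-≡⁻ P Q same-shape

  P-bounded : ∀ i → All (_≤ n) (row P i)
  P-bounded i = All.map proj₂ (P-range i)

  Q-bounded : ∀ i → All (_≤ m) (row Q i)
  Q-bounded i = All.map proj₂ (Q-range i)

  Q-above : ∀ i v → v ≤ i → #≤ v (row Q i) ≡ 0
  Q-above = CountingSSYT.#≤-below-diagonal Q-counting (#≤-none (row Q 0) (All.map proj₁ (Q-range 0)))

  λ-chain : ∀ j t → lam d Q (suc j) (suc t) ≤ lam d Q j t
  λ-chain zero    t = ≤-trans (#≤≤length (suc t) (row Q 0)) (subst (_≤ d) (length-PQ 0) P₀-width)
    where
    P₀-width : length (row P 0) ≤ d
    P₀-width with 0 <? m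
    ... | yes 0<m = subst (λ r → length r ≤ d) (lookup-fromℕ< P 0<m) (P-width (fromℕ< 0<m))
    ... | no 0≮m rewrite row-beyond P 0 (≮⇒≥ 0≮m) = z≤n
  λ-chain (suc j) t = CountingSSYT.shifted Q-counting j t

  compatible : Compatible d n P Q
  compatible = record
    { P-sorted  = CountingSSYT.sorted P-counting
    ; P-bounded = P-bounded
    ; length-P  = λ i → trans (length-PQ i) (sym (#≤-all (row Q i) (Q-bounded i)))
    ; λ-chain   = λ-chain
    ; Q-above   = Q-above
    }

  open θ-Rows compatible
  open θ-Type compatible

  θ-counting : CountingSSYT θ
  θ-counting = record { sorted = sorted ; shifted = shifted ; shrinking = shrinking }
    where
    sorted : ∀ i → Sorted (row θ i)
    sorted i with i <? m
    ... | yes i<m = θ-row-sorted i i<m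
    ... | no i≮m rewrite row-beyond θ i (≮⇒≥ i≮m) = []
    shrinking : ∀ i → length (row θ (suc i)) ≤ length (row θ i)
    shrinking i with suc i <? m
    ... | yes i+1<m = ≤-reflexive (trans (θ-row-length (suc i) i+1<m) (sym (θ-row-length i (<-trans (n<1+n i) i+1<m))))
    ... | no i+1≮m rewrite row-beyond θ (suc i) (≮⇒≥ i+1≮m) = z≤n
    shifted : ∀ i → Shifted (row θ i) (row θ (suc i))
    shifted i with suc i <? m
    ... | no i+1≮m rewrite row-beyond θ (suc i) (≮⇒≥ i+1≮m) = λ _ → z≤n
    ... | yes i+1<m = λ v → shifted-at v (v <? n)
      where
      i<m = <-trans (n<1+n i) i+1<m
      -- Below n the rows are those of P; from n on, λ_j(t) is monotone in t.
      shifted-at : ∀ v → Dec (v < n) → #≤ (suc v) (row θ (suc i)) ≤ #≤ v (row θ i)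
      shifted-at v (yes v<n) = subst₂ _≤_ (sym (#≤-θ-low (suc i) i+1<m (suc v) v<n)) (sym (#≤-θ-low i i<m v (<⇒≤ v<n)))
        (CountingSSYT.shifted P-counting i v)
      shifted-at v (no v≮n) = subst (λ w → #≤ (suc w) (row θ (suc i)) ≤ #≤ w (row θ i)) (m+[n∸m]≡n (≮⇒≥ v≮n))
        (shifted-high (v ∸ n))
        where
        shifted-high : ∀ K → #≤ (suc (n + K)) (row θ (suc i)) ≤ #≤ (n + K) (row θ i)
        shifted-high K = subst₂ _≤_
          (sym (trans (cong (λ w → #≤ w (row θ (suc i))) (sym (+-suc n K))) (#≤-θ-high (suc i) i+1<m (suc K))))
          (sym (#≤-θ-high i i<m K)) (Λ-step (suc i) K)

  θ-no-zero : #≤ 0 (row θ 0) ≡ 0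
  θ-no-zero with 0 <? m
  ... | yes 0<m = trans (#≤-θ-low 0 0<m 0 z≤n) (#≤-none (row P 0) (All.map proj₁ (P-range 0)))
  ... | no 0≮m rewrite row-beyond θ 0 (≮⇒≥ 0≮m) = refl

  θ-type : HasType θ (TType d α β)
  θ-type zero = trans (count-θ-low 0 z≤n) (P-type 0)
  θ-type (suc k) with k <? n
  ... | yes k<n = trans (count-θ-low (suc k) k<n) (trans (P-type (suc k)) (sym (part-TType-α d α β k k<n)))
  ... | no k≮n  = subst (λ k → count (suc k) θ ≡ part (TType d α β) (suc k)) (m+[n∸m]≡n (≮⇒≥ k≮n)) (high (k ∸ n))
    where
    high : ∀ K → count (suc (n + K)) θ ≡ part (TType d α β) (suc (n + K))
    high K with K <? m
    ... | yes K<m = begin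
      count (suc (n + K)) θ                                          ≡⟨ sym (m+n∸n≡m _ (count (m ∸ K) Q)) ⟩
      count (suc (n + K)) θ + count (m ∸ K) Q ∸ count (m ∸ K) Q
        ≡⟨ cong₂ _∸_ (count-θ-high K K<m) (Q-type (m ∸ K)) ⟩
      d ∸ part β (m ∸ K)                                             ≡⟨ sym (part-TType-β d α β K K<m) ⟩
      part (TType d α β) (suc (n + K))                               ∎
      where open ≡-Reasoning
    ... | no K≮m = trans (count-θ-beyond K (≮⇒≥ K≮m)) (sym (part-TType-beyond d α β K (≮⇒≥ K≮m)))

  θ∈T : InT d α β θ
  θ∈T = CountingSSYT⇒IsSSYT θ θ-counting θ-no-zero
      , (λ r → trans (cong length (lookup≡row θ r)) (θ-row-length (toℕ r) (toℕ<n r)))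
      , θ-type

  #≤-Q-via-θ : ∀ i t → i < t → t ≤ m → #≤ t (row Q i) ≡ #≤ (n + (m ∸ t)) (row θ (i + (m ∸ t)))
  #≤-Q-via-θ i t i<t t≤m = sym (trans (#≤-θ-high (i + s) i+s<m s)
    (cong₂ (lam d Q) (trans (cong (λ a → suc a ∸ s) (+-comm i s)) (1+[m+n]∸m≡1+n s i))
                     (m∸[m∸n]≡n t≤m)))
    where
    s = m ∸ t
    i+s<m : i + s < m
    i+s<m = <-≤-trans (+-monoˡ-< s i<t) (≤-reflexive (m+[n∸m]≡n t≤m))

θ-injective : ∀ {d n m} {α : Vec ℕ n} {β : Vec ℕ m} {P Q P′ Q′ : Tableau m} →
  InS d α β P Q → InS d α β P′ Q′ → theta d n P Q ≡ theta d n P′ Q′ → (P ≡ P′) × (Q ≡ Q′)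
θ-injective {d} {n} {m} {P = P} {Q} {P′} {Q′} pq∈S pq′∈S θ≡θ′ = P≡P′ , Q≡Q′
  where
  module S  = θ-on-S pq∈S
  module S′ = θ-on-S pq′∈S
  open θ-Rows using (#≤-θ-low)
  row-θ≡ : ∀ i → row (theta d n P Q) i ≡ row (theta d n P′ Q′) i
  row-θ≡ i = cong (λ X → row X i) θ≡θ′
  P≡P′ : P ≡ P′
  P≡P′ = row-ext P P′ λ i i<m →
    #≤-injective _ _ (CountingSSYT.sorted S.P-counting i) (CountingSSYT.sorted S′.P-counting i) λ v → begin
      #≤ v (row P i)                  ≡⟨ #≤-⊓ (row P i) (S.P-bounded i) v ⟩
      #≤ (v ⊓ n) (row P i)            ≡⟨ sym (#≤-θ-low S.compatible i i<m (v ⊓ n) (m⊓n≤n v n)) ⟩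
      #≤ (v ⊓ n) (row (theta d n P Q) i)   ≡⟨ cong (#≤ (v ⊓ n)) (row-θ≡ i) ⟩
      #≤ (v ⊓ n) (row (theta d n P′ Q′) i) ≡⟨ #≤-θ-low S′.compatible i i<m (v ⊓ n) (m⊓n≤n v n) ⟩
      #≤ (v ⊓ n) (row P′ i)           ≡⟨ sym (#≤-⊓ (row P′ i) (S′.P-bounded i) v) ⟩
      #≤ v (row P′ i)                 ∎
    where open ≡-Reasoning
  Q≡Q′ : Q ≡ Q′
  Q≡Q′ = row-ext Q Q′ λ i i<m →
    #≤-injective _ _ (CountingSSYT.sorted S.Q-counting i) (CountingSSYT.sorted S′.Q-counting i) λ t →
      trans (#≤-⊓ (row Q i) (S.Q-bounded i) t)
        (trans (same-#≤ i i<m (t ⊓ m) (m⊓n≤n t m)) (sym (#≤-⊓ (row Q′ i) (S′.Q-bounded i) t)))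
    where
    same-#≤ : ∀ i → i < m → ∀ t → t ≤ m → #≤ t (row Q i) ≡ #≤ t (row Q′ i)
    same-#≤ i i<m t t≤m with t ≤? i
    ... | yes t≤i = trans (S.Q-above i t t≤i) (sym (S′.Q-above i t t≤i))
    ... | no t≰i  = trans (S.#≤-Q-via-θ i t (≰⇒> t≰i) t≤m)
                   (trans (cong (#≤ (n + (m ∸ t))) (row-θ≡ (i + (m ∸ t)))) (sym (S′.#≤-Q-via-θ i t (≰⇒> t≰i) t≤m)))

-- The inverse of θ

module θ-inverse {N d n m} {α : Vec ℕ n} {β : Vec ℕ m} (α-comp : IsComposition N α) (β-comp : IsComposition N β)
                 {T : Tableau m} (T∈T : InT d α β T) where
  private
    T-ssyt  = proj₁ T∈T
    T-width = proj₁ (proj₂ T∈T)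
    T-type  = proj₂ (proj₂ T∈T)

  T-counting : CountingSSYT T
  T-counting = IsSSYT⇒CountingSSYT T T-ssyt

  open CountingSSYT T-counting using () renaming (sorted to T-sorted; shifted to T-shifted; #≤-antitone to T-antitone)

  T-range : ∀ i → All (λ x → 0 < x × x ≤ n + m) (row T i)
  T-range = HasType⇒entries-in-range T (TType d α β) T-type

  T-row-length : ∀ i → i < m → length (row T i) ≡ d
  T-row-length i i<m = trans (cong length (sym (lookup-fromℕ< T i<m))) (T-width (fromℕ< i<m))

  #≤-T≤d : ∀ i v → #≤ v (row T i) ≤ d
  #≤-T≤d i v with i <? m
  ... | yes i<m = ≤-trans (#≤≤length v (row T i)) (≤-reflexive (T-row-length i i<m))
  ... | no i≮m rewrite row-beyond T i (≮⇒≥ i≮m) = z≤n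

  -- Column strictness pushes the bound n + m on the last row up to the bound n + i + 1 on row i.
  #≤-T-full : ∀ i → i < m → ∀ v → n + suc i ≤ v → #≤ v (row T i) ≡ d
  #≤-T-full i i<m v n+i<v =
    ≤-antisym (#≤-T≤d i v) (≤-trans (full (m ∸ suc i) i (m+[n∸m]≡n i<m)) (#≤-mono (row T i) n+i<v))
    where
    full : ∀ s i → suc i + s ≡ m → d ≤ #≤ (n + suc i) (row T i)
    full zero i i+1≡m = ≤-reflexive (sym (trans (#≤-all (row T i) last-row-bounded) (T-row-length i (≤-reflexive i+1≡m′))))
      where
      i+1≡m′ : suc i ≡ m
      i+1≡m′ = trans (sym (+-identityʳ _)) i+1≡m
      last-row-bounded : All (_≤ n + suc i) (row T i)
      last-row-bounded = All.map (λ (_ , x≤n+m) → ≤-trans x≤n+m (≤-reflexive (cong (n +_) (sym i+1≡m′)))) (T-range i)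
    full (suc s) i i+s+1≡m = ≤-trans (full s (suc i) (trans (sym (+-suc (suc i) s)) i+s+1≡m))
      (subst (λ w → #≤ w (row T (suc i)) ≤ #≤ (n + suc i) (row T i)) (sym (+-suc n (suc i))) (T-shifted i (n + suc i)))

  P : Tableau m
  P = Vec.map (filter≤ n) T

  row-P : ∀ i → row P i ≡ filter≤ n (row T i)
  row-P = row-map (filter≤ n) refl T

  #≤-P : ∀ i v → #≤ v (row P i) ≡ #≤ (v ⊓ n) (row T i)
  #≤-P i v = trans (cong (#≤ v) (row-P i)) (#≤-filter≤ n v (row T i))

  length-P : ∀ i → length (row P i) ≡ #≤ n (row T i)
  length-P i = cong length (row-P i)

  P-bounded : ∀ i → All (_≤ n) (row P i)
  P-bounded i = subst (All (_≤ n)) (sym (row-P i))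
    (All.map (λ {x} → ≤ᵇ⇒≤ x n) (All.all-filter (λ y → T? (y ≤ᵇ n)) (row T i)))

  #≤-P-low : ∀ i v → v ≤ n → #≤ v (row P i) ≡ #≤ v (row T i)
  #≤-P-low i v v≤n = trans (#≤-P i v) (cong (λ w → #≤ w (row T i)) (m≤n⇒m⊓n≡m v≤n))

  #≤-P-high : ∀ i v → n ≤ v → #≤ v (row P i) ≡ #≤ n (row T i)
  #≤-P-high i v n≤v = trans (#≤-P i v) (cong (λ w → #≤ w (row T i)) (m≥n⇒m⊓n≡n n≤v))

  P-counting : CountingSSYT P
  P-counting = record { sorted = sorted ; shifted = shifted ; shrinking = shrinking }
    where
    sorted : ∀ i → Sorted (row P i)
    sorted i = subst Sorted (sym (row-P i)) (AllPairs.filter⁺ (λ y → T? (y ≤ᵇ n)) (T-sorted i))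
    shifted : ∀ i → Shifted (row P i) (row P (suc i))
    shifted i v with v <? n
    ... | yes v<n = subst₂ _≤_ (sym (#≤-P-low (suc i) (suc v) v<n)) (sym (#≤-P-low i v (<⇒≤ v<n))) (T-shifted i v)
    ... | no v≮n  = subst₂ _≤_ (sym (#≤-P-high (suc i) (suc v) (m≤n⇒m≤1+n n≤v))) (sym (#≤-P-high i v n≤v))
                      (T-antitone i n)
      where n≤v = ≮⇒≥ v≮n
    shrinking : ∀ i → length (row P (suc i)) ≤ length (row P i)
    shrinking i = subst₂ _≤_ (sym (length-P (suc i))) (sym (length-P i)) (T-antitone i n)

  P-no-zero : #≤ 0 (row P 0) ≡ 0
  P-no-zero = trans (#≤-P 0 0) (#≤-none (row T 0) (All.map proj₁ (T-range 0)))

  -- μ i is the counting function of row i of Q, read off from T as in #≤-Q-via-θ.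
  μ : ℕ → ℕ → ℕ
  μ i t with i <? t
  ... | yes _ = #≤ (n + (m ∸ t)) (row T (i + (m ∸ t)))
  ... | no _  = 0

  μ-above : ∀ i t → i < t → μ i t ≡ #≤ (n + (m ∸ t)) (row T (i + (m ∸ t)))
  μ-above i t i<t with i <? t
  ... | yes _   = refl
  ... | no i≮t = ⊥-elim (i≮t i<t)

  μ-below : ∀ i t → t ≤ i → μ i t ≡ 0
  μ-below i t t≤i with i <? t
  ... | yes i<t = ⊥-elim (<⇒≱ i<t t≤i)
  ... | no _    = refl

  μ-mono : ∀ i t → t < m → μ i t ≤ μ i (suc t)
  μ-mono i t t<m with i <? t
  ... | no _    = z≤n
  ... | yes i<t = subst₂ _≤_ (cong₂ (λ r w → #≤ w (row T r)) (sym i+s≡) (sym n+s≡))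
                             (sym (μ-above i (suc t) (m<n⇒m<1+n i<t))) (T-shifted (i + s) (n + s))
    where
    s = m ∸ suc t
    i+s≡ : i + (m ∸ t) ≡ suc (i + s)
    i+s≡ = trans (cong (i +_) (∸-suc t<m)) (+-suc i s)
    n+s≡ : n + (m ∸ t) ≡ suc (n + s)
    n+s≡ = trans (cong (n +_) (∸-suc t<m)) (+-suc n s)

  μ-top : ∀ i → i < m → μ i m ≡ #≤ n (row T i)
  μ-top i i<m = begin
    μ i m                                      ≡⟨ μ-above i m i<m ⟩
    #≤ (n + (m ∸ m)) (row T (i + (m ∸ m)))     ≡⟨ cong (λ s → #≤ (n + s) (row T (i + s))) (n∸n≡0 m) ⟩
    #≤ (n + 0) (row T (i + 0))                 ≡⟨ cong₂ (λ a r → #≤ a (row T r)) (+-identityʳ n) (+-identityʳ i) ⟩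
    #≤ n (row T i)                             ∎
    where open ≡-Reasoning

  Q : Tableau m
  Q = Vec.tabulate (λ r → staircase (μ (toℕ r)) 0 m)

  row-Q : ∀ i → i < m → row Q i ≡ staircase (μ i) 0 m
  row-Q i i<m = row-tabulate (λ i → staircase (μ i) 0 m) i i<m

  #≤-Q : ∀ i → i < m → ∀ v → #≤ v (row Q i) ≡ μ i (v ⊓ m)
  #≤-Q i i<m v = trans (cong (#≤ v) (row-Q i i<m))
    (#≤-staircase (μ i) 0 m (λ t t<m → μ-mono i t t<m) v)

  Q-bounded : ∀ i → All (_≤ m) (row Q i)
  Q-bounded i with i <? m
  ... | yes i<m = subst (All (_≤ m)) (sym (row-Q i i<m)) (All.map proj₂ (staircase-bounded (μ i) 0 m))
  ... | no i≮m rewrite row-beyond Q i (≮⇒≥ i≮m) = []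

  length-PQ : ∀ i → length (row P i) ≡ length (row Q i)
  length-PQ i with i <? m
  ... | yes i<m = begin
    length (row P i)    ≡⟨ length-P i ⟩
    #≤ n (row T i)      ≡⟨ sym (μ-top i i<m) ⟩
    μ i m               ≡⟨ cong (μ i) (sym (⊓-idem m)) ⟩
    μ i (m ⊓ m)         ≡⟨ sym (#≤-Q i i<m m) ⟩
    #≤ m (row Q i)      ≡⟨ #≤-all (row Q i) (Q-bounded i) ⟩
    length (row Q i)    ∎
    where open ≡-Reasoning
  ... | no i≮m rewrite row-beyond P i (≮⇒≥ i≮m) | row-beyond Q i (≮⇒≥ i≮m) = refl

  μ-shifted : ∀ i t → t < m → μ (suc i) (suc t) ≤ μ i t
  μ-shifted i t t<m with t ≤? i
  ... | yes t≤i = ≤-trans (≤-reflexive (μ-below (suc i) (suc t) (s≤s t≤i))) z≤n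
  ... | no t≰i  = subst₂ _≤_ (sym (μ-above (suc i) (suc t) (s≤s (≰⇒> t≰i)))) (sym (μ-above i t (≰⇒> t≰i)))
    (subst (λ r → #≤ (n + s) (row T (suc i + s)) ≤ #≤ (n + (m ∸ t)) (row T r)) (sym i+s≡)
      (#≤-mono (row T (suc i + s)) (+-monoʳ-≤ n (∸-monoʳ-≤ m (n≤1+n t)))))
    where
    s = m ∸ suc t
    i+s≡ : i + (m ∸ t) ≡ suc i + s
    i+s≡ = trans (cong (i +_) (∸-suc t<m)) (+-suc i s)

  Q-counting : CountingSSYT Q
  Q-counting = record { sorted = sorted ; shifted = shifted ; shrinking = shrinking }
    where
    sorted : ∀ i → Sorted (row Q i)
    sorted i with i <? m
    ... | yes i<m = subst Sorted (sym (row-Q i i<m)) (staircase-sorted (μ i) 0 m)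
    ... | no i≮m rewrite row-beyond Q i (≮⇒≥ i≮m) = []
    shrinking : ∀ i → length (row Q (suc i)) ≤ length (row Q i)
    shrinking i = subst₂ _≤_ (length-PQ (suc i)) (length-PQ i) (CountingSSYT.shrinking P-counting i)
    shifted : ∀ i → Shifted (row Q i) (row Q (suc i))
    shifted i v with suc i <? m
    ... | no i+1≮m rewrite row-beyond Q (suc i) (≮⇒≥ i+1≮m) = z≤n
    ... | yes i+1<m = subst₂ _≤_ (sym (#≤-Q (suc i) i+1<m (suc v))) (sym (#≤-Q i i<m v)) (μ-shifted-⊓ (v <? m))
      where
      i<m = <-trans (n<1+n i) i+1<m
      μ-shifted-⊓ : Dec (v < m) → μ (suc i) (suc v ⊓ m) ≤ μ i (v ⊓ m)
      μ-shifted-⊓ (yes v<m) =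
        subst₂ (λ a b → μ (suc i) a ≤ μ i b) (sym (m≤n⇒m⊓n≡m v<m)) (sym (m≤n⇒m⊓n≡m (<⇒≤ v<m)))
        (μ-shifted i v v<m)
      μ-shifted-⊓ (no v≮m) = subst₂ (λ a b → μ (suc i) a ≤ μ i b)
        (sym (m≥n⇒m⊓n≡n (m≤n⇒m≤1+n (≮⇒≥ v≮m)))) (sym (m≥n⇒m⊓n≡n (≮⇒≥ v≮m)))
        (subst₂ _≤_ (sym (μ-top (suc i) i+1<m)) (sym (μ-top i i<m)) (T-antitone i n))

  Q-no-zero : #≤ 0 (row Q 0) ≡ 0
  Q-no-zero with 0 <? m
  ... | yes 0<m = trans (#≤-Q 0 0<m 0) (μ-below 0 0 z≤n)
  ... | no 0≮m rewrite row-beyond Q 0 (≮⇒≥ 0≮m) = refl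

  Q-above : ∀ i v → v ≤ i → #≤ v (row Q i) ≡ 0
  Q-above = CountingSSYT.#≤-below-diagonal Q-counting Q-no-zero

  P-width : ∀ i → length (row P i) ≤ d
  P-width i = subst (_≤ d) (sym (length-P i)) (#≤-T≤d i n)

  compatible : Compatible d n P Q
  compatible = record
    { P-sorted  = CountingSSYT.sorted P-counting
    ; P-bounded = P-bounded
    ; length-P  = λ i → trans (length-PQ i) (sym (#≤-all (row Q i) (Q-bounded i)))
    ; λ-chain   = λ-chain
    ; Q-above   = Q-above
    }
    where
    λ-chain : ∀ j t → lam d Q (suc j) (suc t) ≤ lam d Q j t
    λ-chain zero    t = ≤-trans (#≤≤length (suc t) (row Q 0)) (subst (_≤ d) (length-PQ 0) (P-width 0))
    λ-chain (suc j) t = CountingSSYT.shifted Q-counting j t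

  open θ-Rows compatible
  open θ-Type compatible

  θ≡T : θ ≡ T
  θ≡T = row-ext θ T λ i i<m → #≤-injective _ _ (θ-row-sorted i i<m) (T-sorted i) (same-#≤ i i<m)
    where
    same-#≤ : ∀ i → i < m → ∀ v → #≤ v (row θ i) ≡ #≤ v (row T i)
    same-#≤ i i<m v with v ≤? n
    ... | yes v≤n = trans (#≤-θ-low i i<m v v≤n) (#≤-P-low i v v≤n)
    ... | no v≰n  = subst (λ w → #≤ w (row θ i) ≡ #≤ w (row T i)) (m+[n∸m]≡n (<⇒≤ (≰⇒> v≰n)))
                      (trans (#≤-θ-high i i<m (v ∸ n)) (Λ≡#≤-T (v ∸ n) (v ∸ n ≤? i)))
      where
      Λ≡#≤-T : ∀ K → Dec (K ≤ i) → Λ (suc i) K ≡ #≤ (n + K) (row T i)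
      Λ≡#≤-T K (no K≰i)  =
        trans (Λ-beyond (suc i) K (≰⇒> K≰i)) (sym (#≤-T-full i i<m (n + K) (+-monoʳ-≤ n (≰⇒> K≰i))))
      Λ≡#≤-T K (yes K≤i) = begin
        lam d Q (suc i ∸ K) (m ∸ K)                     ≡⟨ cong (λ r → lam d Q r (m ∸ K)) (+-∸-assoc 1 K≤i) ⟩
        #≤ (m ∸ K) (row Q (i ∸ K))                      ≡⟨ #≤-Q (i ∸ K) (≤-<-trans (m∸n≤m i K) i<m) (m ∸ K) ⟩
        μ (i ∸ K) ((m ∸ K) ⊓ m)                          ≡⟨ cong (μ (i ∸ K)) (m≤n⇒m⊓n≡m (m∸n≤m m K)) ⟩
        μ (i ∸ K) (m ∸ K)                               ≡⟨ μ-above (i ∸ K) (m ∸ K) (∸-monoˡ-< i<m K≤i) ⟩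
        #≤ (n + (m ∸ (m ∸ K))) (row T (i ∸ K + (m ∸ (m ∸ K))))
          ≡⟨ cong₂ (λ a b → #≤ (n + a) (row T (i ∸ K + b))) (m∸[m∸n]≡n K≤m) (m∸[m∸n]≡n K≤m) ⟩
        #≤ (n + K) (row T (i ∸ K + K))                  ≡⟨ cong (λ r → #≤ (n + K) (row T r)) (m∸n+n≡m K≤i) ⟩
        #≤ (n + K) (row T i)                            ∎
        where
        open ≡-Reasoning
        K≤m = ≤-trans K≤i (<⇒≤ i<m)

  P-type : HasType P α
  P-type zero    = trans (sym (count-θ-low 0 z≤n)) (trans (cong (count 0) θ≡T) (T-type 0))
  P-type (suc k) with suc k ≤? n
  ... | yes k<n = trans (sym (count-θ-low (suc k) k<n)) (trans (cong (count (suc k)) θ≡T)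
                    (trans (T-type (suc k)) (part-TType-α d α β k k<n)))
  ... | no k≮n  = trans (count-beyond P P-bounded k (≤-pred (≰⇒> k≮n))) (sym (part-beyond α (suc k) (≰⇒> k≮n)))

  count-Q-0 : count 0 Q ≡ 0
  count-Q-0 = trans (count-0 Q) (∑<-zero m _ (λ i _ → Q-above i 0 z≤n))

  count-Q≤β : ∀ k → k < m → count (suc k) Q ≤ part β (suc k)
  count-Q≤β k k<m = subst (λ j → count j Q ≤ part β j) (m∸[m∸n]≡n k<m) (begin
    count (m ∸ K) Q                    ≡⟨ sym (m+n∸m≡n cT (count (m ∸ K) Q)) ⟩
    cT + count (m ∸ K) Q ∸ cT          ≡⟨ cong₂ _∸_ cT+cQ≡d cT≡ ⟩
    d ∸ (d ∸ part β (m ∸ K))           ≤⟨ m∸[m∸n]≤n d (part β (m ∸ K)) ⟩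
    part β (m ∸ K)                     ∎)
    where
    open ≤-Reasoning
    K = m ∸ suc k
    K<m : K < m
    K<m = subst (_≤ m) (∸-suc k<m) (m∸n≤m m k)
    cT = count (suc (n + K)) T
    cT+cQ≡d : cT + count (m ∸ K) Q ≡ d
    cT+cQ≡d = subst (λ X → count (suc (n + K)) X + count (m ∸ K) Q ≡ d) θ≡T (count-θ-high K K<m)
    cT≡ : cT ≡ d ∸ part β (m ∸ K)
    cT≡ = trans (T-type (suc (n + K))) (part-TType-β d α β K K<m)

  ∑count-Q≡∑β : ∑[ k < m ] count (suc k) Q ≡ ∑[ k < m ] part β (suc k)
  ∑count-Q≡∑β = begin
    ∑[ k < m ] count (suc k) Q                  ≡⟨ cong (_+ ∑[ k < m ] count (suc k) Q) (sym count-Q-0) ⟩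
    count 0 Q + ∑[ k < m ] count (suc k) Q      ≡⟨ sym (#≤ᵗ-telescope Q m) ⟩
    ∑[ i < m ] #≤ m (row Q i)                   ≡⟨ ∑<-cong m (λ i _ → #≤-all (row Q i) (Q-bounded i)) ⟩
    ∑[ i < m ] length (row Q i)                 ≡⟨ ∑<-cong m (λ i _ → sym (length-PQ i)) ⟩
    ∑[ i < m ] length (row P i)                 ≡⟨ ∑<-cong m (λ i _ → sym (#≤-all (row P i) (P-bounded i))) ⟩
    #≤ᵗ n P                                     ≡⟨ #≤ᵗ-total P α P-type ⟩
    Vec.sum α                                   ≡⟨ trans (proj₂ α-comp) (sym (proj₂ β-comp)) ⟩
    Vec.sum β                                   ≡⟨ sym (∑<-part β) ⟩
    ∑[ k < m ] part β (suc k)                   ∎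
    where open ≡-Reasoning

  Q-type : HasType Q β
  Q-type zero    = count-Q-0
  Q-type (suc k) with k <? m
  ... | yes k<m = ∑<-≡-termwise m count-Q≤β ∑count-Q≡∑β k k<m
  ... | no k≮m  = trans (count-beyond Q Q-bounded k (≮⇒≥ k≮m)) (sym (part-beyond β (suc k) (s≤s (≮⇒≥ k≮m))))

  PQ∈S : InS d α β P Q
  PQ∈S = CountingSSYT⇒IsSSYT P P-counting P-no-zero
       , CountingSSYT⇒IsSSYT Q Q-counting Q-no-zero
       , map-length-≡ P Q (λ i _ → length-PQ i)
       , (λ r → subst (_≤ d) (sym (cong length (lookup≡row P r))) (P-width (toℕ r)))
       , P-type
       , Q-type

theorem4p3 : ∀ (N n m d : ℕ) (α : Vec ℕ n) (β : Vec ℕ m) →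
    IsComposition N α → IsComposition N β →
    -- well defined: θ maps 𝔖_d(α,β) into 𝔗_d(α,β)
    (∀ (P Q : Tableau m) → InS d α β P Q → InT d α β (theta d n P Q)) ×
    -- injective on 𝔖_d(α,β)
    (∀ (P Q P′ Q′ : Tableau m) → InS d α β P Q → InS d α β P′ Q′ →
      theta d n P Q ≡ theta d n P′ Q′ → (P ≡ P′) × (Q ≡ Q′)) ×
    -- surjective onto 𝔗_d(α,β)
    (∀ (T : Tableau m) → InT d α β T →
      Σ (Tableau m) (λ P → Σ (Tableau m) (λ Q → InS d α β P Q × (theta d n P Q ≡ T))))
theorem4p3 N n m d α β α-comp β-comp =
    (λ P Q pq∈S → θ-on-S.θ∈T pq∈S)
  , (λ P Q P′ Q′ → θ-injective)
  , λ T T∈T → let open θ-inverse α-comp β-comp T∈T in P , Q , PQ∈S , θ≡T
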